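{- Let $n\ge 1$ and let $h:\{1,\dots,n\}\to\{1,\dots,n\}$ be a weakly increasing function with $h(i)\ge i$ for all $i$. Let $G$ be the graph on vertex set $\{1,\dots,n\}$ whose edges are the pairs $\{i,j\}$ with $i<j\le h(i)$. Then $$\sum_{w} t^{\mathrm{inv}_h(w)} \;=\; \prod_{i=1}^n [h(i)-i+1]_t \;=\; \sum_{o} t^{\mathrm{des}(o)},$$ where the first sum runs over all Tymoczko configurations $w$ of shape $(n)$ for $h$, and the last sum runs over all acyclic orientations $o$ of $G$.
   Context: $[m]_t=1+t+\cdots+t^{m-1}$. A Tymoczko configuration of shape $(n)$ for $h$ is a permutation $w_1w_2\cdots w_n$ of $\{1,\dots,n\}$ (written as a word) such that $w_k\le h(w_{k+1})$ for every $1\le k<n$. An $h$-inversion of such a word is a pair $(a,b)$ with $a<b$ such that $b$ appears strictly to the left of $a$ and, if $a$ is immediately followed in the word by some letter $c$, then $b\le h(c)$; $\mathrm{inv}_h(w)$ is the number of $h$-inversions of $w$. An acyclic orientation $o$ of $G$ assigns a direction to each edge so that there are no directed cycles; $\mathrm{des}(o)$ is the number of edges $\{i<j\}$ oriented as the arc $j\to i$. -}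

module Defs where

open import Level using (Level)
open import Data.Bool using (Bool; true; false; _∧_; if_then_else_)
open import Data.Nat as ℕ using (ℕ; zero; suc; _∸_)
open import Data.Fin as F using (Fin; toℕ)
open import Data.Fin.Properties using (_≟_)
open import Data.List using (List; allFin; []; _∷_; _++_; [_]; map; concatMap; length; filter; lookup; foldr)
open import Data.List.Relation.Unary.Unique.Propositional using (Unique)
open import Data.List.Relation.Unary.Linked using (Linked)
open import Data.Vec as V using (Vec)
open import Data.Product using (Σ; _×_; _,_)
open import Data.Sum using (_⊎_)
open import Relation.Binary.PropositionalEquality using (_≡_)
open import Relation.Nullary using (¬_)
open import Algebra.Bundles using (CommutativeSemiring)

-- Conventions: vertices/letters {1,…,n} are represented by Fin n
-- (value i+1 ↦ i); all order comparisons are on toℕ, which is order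
-- preserving, so every condition below is the paper's condition shifted by 1.

WeaklyIncreasing : {n : ℕ} → (Fin n → Fin n) → Set
WeaklyIncreasing {n} h = (i j : Fin n) → toℕ i ℕ.≤ toℕ j → toℕ (h i) ℕ.≤ toℕ (h j)

Extensive : {n : ℕ} → (Fin n → Fin n) → Set
Extensive {n} h = (i : Fin n) → toℕ i ℕ.≤ toℕ (h i)

allWords : (n k : ℕ) → List (List (Fin n))
allWords n zero    = [] ∷ []
allWords n (suc k) = concatMap (λ w → map (_∷ w) (allFin n)) (allWords n k)

-- A word of length n over Fin n is a permutation iff its letters are distinct.
-- Tymoczko condition: w_k ≤ h(w_{k+1}) for all consecutive letters.
TymCond : {n : ℕ} → (Fin n → Fin n) → List (Fin n) → Set
TymCond h w = Linked (λ a b → toℕ a ℕ.≤ toℕ (h b)) w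

IsTymoczko : {n : ℕ} → (Fin n → Fin n) → List (Fin n) → Set
IsTymoczko h w = Unique w × TymCond h w

countᵇ : {A : Set} → (A → Bool) → List A → ℕ
countᵇ p []       = 0
countᵇ p (x ∷ xs) = (if p x then 1 else 0) ℕ.+ countᵇ p xs

-- condition "if a is immediately followed by c then b ≤ h(c)", given the
-- part of the word strictly to the right of a
followCond : {n : ℕ} → (Fin n → Fin n) → Fin n → List (Fin n) → Bool
followCond h b []      = true
followCond h b (c ∷ _) = toℕ b ℕ.≤ᵇ toℕ (h c)

-- invAux pre rest: h-inversions (a,b) where a is a letter of rest and b is
-- to the left of a (in pre, or earlier in rest)
invAux : {n : ℕ} → (Fin n → Fin n) → List (Fin n) → List (Fin n) → ℕ
invAux h pre []         = 0
invAux h pre (a ∷ rest) =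
  countᵇ (λ b → (toℕ a ℕ.<ᵇ toℕ b) ∧ followCond h b rest) pre
  ℕ.+ invAux h (pre ++ [ a ]) rest

inv : {n : ℕ} → (Fin n → Fin n) → List (Fin n) → ℕ
inv h w = invAux h [] w

edges : {n : ℕ} → (Fin n → Fin n) → List (Fin n × Fin n)
edges {n} h = concatMap (λ i → map (λ j → (i , j))
                 (filterᵇ (λ j → (toℕ i ℕ.<ᵇ toℕ j) ∧ (toℕ j ℕ.≤ᵇ toℕ (h i))) (allFin n)))
              (allFin n)
  where
  filterᵇ : {A : Set} → (A → Bool) → List A → List A
  filterᵇ p []       = []
  filterᵇ p (x ∷ xs) = if p x then x ∷ filterᵇ p xs else filterᵇ p xs

-- An orientation assigns to the k-th edge (i , j), i < j, a Bool:
-- false = arc i → j,  true = arc j → i.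
Orientation : {n : ℕ} → (Fin n → Fin n) → Set
Orientation h = Vec Bool (length (edges h))

allVecs : (m : ℕ) → List (Vec Bool m)
allVecs zero    = V.[] ∷ []
allVecs (suc m) = concatMap (λ v → (false V.∷ v) ∷ (true V.∷ v) ∷ []) (allVecs m)

allOrientations : {n : ℕ} → (h : Fin n → Fin n) → List (Orientation h)
allOrientations h = allVecs (length (edges h))

Arc : {n : ℕ} → (h : Fin n → Fin n) → Orientation h → Fin n → Fin n → Set
Arc h o u v = Σ (Fin (length (edges h))) λ k →
    (lookup (edges h) k ≡ (u , v) × V.lookup o k ≡ false)
  ⊎ (lookup (edges h) k ≡ (v , u) × V.lookup o k ≡ true)

lastOf : {A : Set} → A → List A → A
lastOf x []       = x
lastOf x (y ∷ ys) = lastOf y ys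

DirectedCycle : {n : ℕ} → (h : Fin n → Fin n) → Orientation h → Set
DirectedCycle {n} h o = Σ (Fin n) λ v → Σ (List (Fin n)) λ vs →
  Unique (v ∷ vs) × Linked (Arc h o) (v ∷ vs) × Arc h o (lastOf v vs) v

Acyclic : {n : ℕ} → (h : Fin n → Fin n) → Orientation h → Set
Acyclic h o = ¬ DirectedCycle h o

des : {n : ℕ} → (h : Fin n → Fin n) → Orientation h → ℕ
des h o = countᵇ (λ b → b) (V.toList o)

-- Polynomial expressions evaluated in an arbitrary commutative semiring
-- (an identity for all commutative semirings R and all t ∈ R is exactly an
-- identity in ℕ[t]).

module Poly {c ℓ : Level} (R : CommutativeSemiring c ℓ) where
  open CommutativeSemiring R

  pow : Carrier → ℕ → Carrier
  pow t zero    = 1#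
  pow t (suc k) = t * pow t k

  qint : Carrier → ℕ → Carrier
  qint t zero    = 0#
  qint t (suc m) = 1# + t * qint t m

  sumL : {A : Set} → (A → Carrier) → List A → Carrier
  sumL f xs = foldr (λ x acc → f x + acc) 0# xs

  prodL : {A : Set} → (A → Carrier) → List A → Carrier
  prodL f xs = foldr (λ x acc → f x * acc) 1# xs

open import Data.List.Relation.Unary.AllPairs using (allPairs?)
open import Data.List.Relation.Unary.Linked using (linked?)
open import Relation.Nullary.Decidable using (_×-dec_; ¬?)
open import Relation.Unary using (Decidable)

isTymoczko? : {n : ℕ} → (h : Fin n → Fin n) → Decidable (IsTymoczko h)
isTymoczko? h w = allPairs? (λ x y → ¬? (x ≟ y)) w ×-dec linked? (λ a b → toℕ a ℕ.≤? toℕ (h b)) w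

tymoczkoConfigs : {n : ℕ} → (Fin n → Fin n) → List (List (Fin n))
tymoczkoConfigs {n} h = filter (isTymoczko? h) (allWords n n)

module Submission where

-- Both sides are built up one vertex at a time, from n down to 1.
--
-- Configurations: a Tymoczko word on the letters above c becomes one on c and those letters by inserting
-- c at the front or right after a letter b ≤ h(c).  There are h(c) − c such letters, and from left to right
-- the admissible positions add 0, 1, …, h(c) − c h-inversions, so every word contributes t^inv [h(c) − c + 1]_t.
--
-- Orientations: as h is weakly increasing, the upper neighbours j of c (c < j ≤ h(c)) form a clique, so an
-- acyclic orientation of the graph on the larger vertices orders them linearly.  Orienting the edges at c
-- keeps acyclicity exactly when the neighbours pointing to c form a down-set of that order; there is one
-- such down-set of each size 0, …, h(c) − c, and its edges are the new descents.

open import Level using (Level)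
open import Function using (id; _∘_; _$_; case_of_)
open import Data.Bool using (Bool; true; false; _∧_; _∨_; if_then_else_; T; T?)
import Data.Bool.Properties as Boolₚ
open import Data.Empty using (⊥; ⊥-elim)
open import Data.Unit using (⊤; tt)
open import Data.Nat as ℕ using (ℕ; zero; suc; _+_; _∸_; _≤_; _<ᵇ_; _≤ᵇ_; z≤n; s≤s)
import Data.Nat.Properties as ℕₚ
open import Data.Fin as Fin using (Fin; toℕ)
import Data.Fin.Properties as Finₚ
open import Data.List using (List; []; _∷_; _++_; [_]; map; concatMap; length; filter; allFin; downFrom; lookup; take; drop)
import Data.List.Properties as Listₚ
open import Data.List.Membership.Propositional using (_∈_; _∉_; find; lose)
open import Data.List.Membership.Propositional.Properties
  using (∈-++⁻; ∈-++⁺ˡ; ∈-++⁺ʳ; ∈-map⁺; ∈-map⁻; map∷⁻; map∷-decomp∈; ∈-concatMap⁺; ∈-concatMap⁻; ∈-∃++; ∈-allFin;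
         ∈-filter⁺; ∈-filter⁻; ∈-downFrom⁺; ∈-downFrom⁻)
open import Data.List.Membership.Propositional.Properties.WithK using (unique∧set⇒bag)
open import Data.List.Relation.Binary.BagAndSetEquality using (∼bag⇒↭)
open import Data.List.Relation.Binary.Permutation.Propositional using (_↭_; ↭-refl; ↭-sym; ↭-trans; prep; swap; ↭⇒↭ₛ)
  renaming (refl to ↭-id; trans to ↭-∘)
import Data.List.Relation.Binary.Permutation.Propositional.Properties as ↭ₚ
open import Data.List.Relation.Unary.Any as Any using (here; there; any?)
open import Data.List.Relation.Unary.All as All using (All; []; _∷_)
import Data.List.Relation.Unary.All.Properties as Allₚ
open import Data.List.Relation.Unary.AllPairs as AllPairs using ([]; _∷_)
open import Data.List.Relation.Unary.Unique.Propositional as Unique using (Unique)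
import Data.List.Relation.Unary.Unique.Propositional.Properties as Uniqueₚ
open import Data.List.Relation.Unary.Linked as Linked using (Linked; []; [-]; _∷_)
import Data.List.Relation.Unary.Linked.Properties as Linkedₚ
open import Data.Product using (Σ; ∃; _×_; _,_; proj₁; proj₂)
open import Data.Vec as Vec using (Vec)
open import Data.Sum using (_⊎_; inj₁; inj₂)
open import Function.Bundles using (mk⇔; module Equivalence)
open import Relation.Nullary using (¬_; ¬?; Dec; yes; no; _×-dec_; _→-dec_)
open import Relation.Nullary.Decidable using (⌊_⌋; toWitness; fromWitness; map′; _⊎-dec_)
open import Relation.Binary.Definitions using (DecidableEquality; tri<; tri≈; tri>)
open import Data.Product.Properties using (≡-dec)
open import Relation.Nullary.Reflects using (ofʸ; ofⁿ)
open import Relation.Unary using (Decidable)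
open import Relation.Binary.PropositionalEquality
  using (_≡_; _≢_; refl; sym; trans; cong; cong₂; subst; subst₂; module ≡-Reasoning)
import Relation.Binary.PropositionalEquality as ≡
open import Algebra.Bundles using (CommutativeSemiring)
open import Data.Nat.Tactic.RingSolver using (solve-∀)
open import Defs

T⇒≡true : ∀ {b} → T b → b ≡ true
T⇒≡true = Equivalence.to Boolₚ.T-≡

T-∧⁺ : ∀ {a b} → T a → T b → T (a ∧ b)
T-∧⁺ {a} {b} x y = Equivalence.from (Boolₚ.T-∧ {a} {b}) (x , y)

T-∧⁻ : ∀ {a b} → T (a ∧ b) → T a × T b
T-∧⁻ {a} {b} = Equivalence.to (Boolₚ.T-∧ {a} {b})

T-∨⁺ˡ : ∀ {a} b → T a → T (a ∨ b)
T-∨⁺ˡ {a} b x = Equivalence.from (Boolₚ.T-∨ {a} {b}) (inj₁ x)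

T-∨⁺ʳ : ∀ a {b} → T b → T (a ∨ b)
T-∨⁺ʳ a {b} y = Equivalence.from (Boolₚ.T-∨ {a} {b}) (inj₂ y)

T-∨⁻ : ∀ {a b} → T (a ∨ b) → T a ⊎ T b
T-∨⁻ {a} {b} = Equivalence.to (Boolₚ.T-∨ {a} {b})

∨-≡ˡ : ∀ {a b} → (T b → T a) → a ∨ b ≡ a
∨-≡ˡ {true}          _   = refl
∨-≡ˡ {false} {false} _   = refl
∨-≡ˡ {false} {true}  b⇒a = ⊥-elim (b⇒a _)

∨-≡ʳ : ∀ {a b} → (T a → T b) → a ∨ b ≡ b
∨-≡ʳ {false}         _   = refl
∨-≡ʳ {true}  {true}  _   = refl
∨-≡ʳ {true}  {false} a⇒b = ⊥-elim (a⇒b _)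

∧-≡ˡ : ∀ {a b} → (T a → T b) → a ∧ b ≡ a
∧-≡ˡ {false}         _   = refl
∧-≡ˡ {true}  {true}  _   = refl
∧-≡ˡ {true}  {false} a⇒b = ⊥-elim (a⇒b _)

∧-≡ʳ : ∀ {a b} → (T b → T a) → a ∧ b ≡ b
∧-≡ʳ {true}          _   = refl
∧-≡ʳ {false} {false} _   = refl
∧-≡ʳ {false} {true}  b⇒a = ⊥-elim (b⇒a _)

<ᵇ-indicator+∸ : ∀ a m → (if a <ᵇ m then 1 else 0) + (m ∸ suc a) ≡ m ∸ a
<ᵇ-indicator+∸ a m with a <ᵇ m | ℕₚ.<ᵇ-reflects-< a m
... | true  | ofʸ a<m = sym (ℕₚ.+-∸-assoc 1 a<m)
... | false | ofⁿ a≮m = trans (ℕₚ.m≤n⇒m∸n≡0 (ℕₚ.m≤n⇒m≤1+n m≤a)) (sym (ℕₚ.m≤n⇒m∸n≡0 m≤a))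
  where m≤a = ℕₚ.≮⇒≥ a≮m

[n∸m]+[o∸n]≡o∸m : ∀ {m n o} → m ℕ.≤ n → n ℕ.≤ o → (n ∸ m) + (o ∸ n) ≡ o ∸ m
[n∸m]+[o∸n]≡o∸m {m} {n} {o} m≤n n≤o = begin
  (n ∸ m) + (o ∸ n)  ≡⟨ ℕₚ.+-comm (n ∸ m) (o ∸ n) ⟩
  (o ∸ n) + (n ∸ m)  ≡⟨ ℕₚ.+-∸-assoc (o ∸ n) m≤n ⟨
  (o ∸ n) + n ∸ m    ≡⟨ cong (_∸ m) (ℕₚ.m∸n+n≡m n≤o) ⟩
  o ∸ m              ∎
  where open ≡-Reasoning

inInterval : ℕ → ℕ → ℕ → Bool
inInterval a b k = (a <ᵇ k) ∧ (k ≤ᵇ b)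

module _ {A : Set} where

  countᵇ-++ : ∀ (p : A → Bool) xs ys → countᵇ p (xs ++ ys) ≡ countᵇ p xs + countᵇ p ys
  countᵇ-++ p []       ys = refl
  countᵇ-++ p (x ∷ xs) ys =
    trans (cong (_ +_) (countᵇ-++ p xs ys)) (sym (ℕₚ.+-assoc (if p x then 1 else 0) _ _))

  countᵇ-cong : ∀ {p q : A → Bool} xs → (∀ {x} → x ∈ xs → p x ≡ q x) → countᵇ p xs ≡ countᵇ q xs
  countᵇ-cong []       eq = refl
  countᵇ-cong (x ∷ xs) eq =
    cong₂ (λ b k → (if b then 1 else 0) + k) (eq (here refl)) (countᵇ-cong xs (eq ∘ there))

  countᵇ-mono : ∀ {p q : A → Bool} xs → (∀ {x} → x ∈ xs → T (p x) → T (q x)) → countᵇ p xs ℕ.≤ countᵇ q xs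
  countᵇ-mono []       imp = z≤n
  countᵇ-mono {p} {q} (x ∷ xs) imp with p x | q x | imp (here refl)
  ... | true  | true  | _  = s≤s (countᵇ-mono xs (imp ∘ there))
  ... | true  | false | pq = ⊥-elim (pq _)
  ... | false | true  | _  = ℕₚ.m≤n⇒m≤1+n (countᵇ-mono xs (imp ∘ there))
  ... | false | false | _  = countᵇ-mono xs (imp ∘ there)

  countᵇ-∷-T : ∀ {p : A → Bool} {x} xs → T (p x) → countᵇ p (x ∷ xs) ≡ suc (countᵇ p xs)
  countᵇ-∷-T {p} {x} xs px with p x
  ... | true = refl

  countᵇ-∷-¬T : ∀ {p : A → Bool} {x} xs → ¬ T (p x) → countᵇ p (x ∷ xs) ≡ countᵇ p xs
  countᵇ-∷-¬T {p} {x} xs ¬px with p x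
  ... | true  = ⊥-elim (¬px _)
  ... | false = refl

  countᵇ-false : ∀ (xs : List A) → countᵇ (λ _ → false) xs ≡ 0
  countᵇ-false []       = refl
  countᵇ-false (x ∷ xs) = countᵇ-false xs

  countᵇ-true : ∀ (xs : List A) → countᵇ (λ _ → true) xs ≡ length xs
  countᵇ-true []       = refl
  countᵇ-true (x ∷ xs) = cong suc (countᵇ-true xs)

  countᵇ-map : ∀ {B : Set} (p : B → Bool) (f : A → B) xs → countᵇ p (map f xs) ≡ countᵇ (p ∘ f) xs
  countᵇ-map p f []       = refl
  countᵇ-map p f (x ∷ xs) = cong (_ +_) (countᵇ-map p f xs)

  countᵇ≡length-filter : ∀ (p : A → Bool) xs → countᵇ p xs ≡ length (filter (T? ∘ p) xs)
  countᵇ≡length-filter p []       = refl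
  countᵇ≡length-filter p (x ∷ xs) with p x
  ... | true  = cong suc (countᵇ≡length-filter p xs)
  ... | false = countᵇ≡length-filter p xs

  countᵇ-interchange : ∀ {p q p′ q′ : A → Bool} xs →
    (∀ {x} → x ∈ xs →
      (if p x then 1 else 0) + (if q x then 1 else 0) ≡ (if p′ x then 1 else 0) + (if q′ x then 1 else 0)) →
    countᵇ p xs + countᵇ q xs ≡ countᵇ p′ xs + countᵇ q′ xs
  countᵇ-interchange []       eq = refl
  countᵇ-interchange {p} {q} {p′} {q′} (x ∷ xs) eq = begin
    (P + countᵇ p xs) + (Q + countᵇ q xs)     ≡⟨ interchange P _ Q _ ⟩
    (P + Q) + (countᵇ p xs + countᵇ q xs)     ≡⟨ cong₂ _+_ (eq (here refl)) (countᵇ-interchange xs (eq ∘ there)) ⟩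
    (P′ + Q′) + (countᵇ p′ xs + countᵇ q′ xs) ≡⟨ interchange P′ Q′ _ _ ⟩
    (P′ + countᵇ p′ xs) + (Q′ + countᵇ q′ xs) ∎
    where
    open ≡-Reasoning
    open import Algebra.Properties.CommutativeSemigroup ℕₚ.+-commutativeSemigroup using (interchange)
    P = if p x then 1 else 0 ; Q = if q x then 1 else 0
    P′ = if p′ x then 1 else 0 ; Q′ = if q′ x then 1 else 0

  unique-↭ : ∀ {xs ys : List A} → Unique xs → Unique ys →
    (∀ {x} → x ∈ xs → x ∈ ys) → (∀ {x} → x ∈ ys → x ∈ xs) → xs ↭ ys
  unique-↭ uxs uys to from = ∼bag⇒↭ (unique∧set⇒bag uxs uys (mk⇔ to from))

  Unique-resp-↭ : ∀ {xs ys : List A} → xs ↭ ys → Unique xs → Unique ys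
  Unique-resp-↭ σ = SetoidProperties.Unique-resp-↭ (↭⇒↭ₛ σ)
    where import Data.List.Relation.Binary.Permutation.Setoid.Properties (≡.setoid A) as SetoidProperties

  countᵇ-↭ : ∀ (p : A → Bool) {xs ys} → xs ↭ ys → countᵇ p xs ≡ countᵇ p ys
  countᵇ-↭ p {xs} {ys} σ = begin
    countᵇ p xs                   ≡⟨ countᵇ≡length-filter p xs ⟩
    length (filter (T? ∘ p) xs)   ≡⟨ ↭ₚ.↭-length (↭ₚ.filter-↭ (T? ∘ p) σ) ⟩
    length (filter (T? ∘ p) ys)   ≡⟨ countᵇ≡length-filter p ys ⟨
    countᵇ p ys                   ∎
    where open ≡-Reasoning

  countᵇ-support : ∀ (p : A → Bool) {xs ys} → Unique xs → Unique ys →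
    (∀ {x} → T (p x) → x ∈ xs → x ∈ ys) → (∀ {x} → T (p x) → x ∈ ys → x ∈ xs) →
    countᵇ p xs ≡ countᵇ p ys
  countᵇ-support p {xs} {ys} uxs uys to from = begin
    countᵇ p xs                   ≡⟨ countᵇ≡length-filter p xs ⟩
    length (filter (T? ∘ p) xs)
      ≡⟨ ↭ₚ.↭-length (unique-↭ (filter⁺ uxs) (filter⁺ uys) (restrict to) (restrict from)) ⟩
    length (filter (T? ∘ p) ys)   ≡⟨ countᵇ≡length-filter p ys ⟨
    countᵇ p ys                   ∎
    where
    open ≡-Reasoning
    filter⁺ : ∀ {us} → Unique us → Unique (filter (T? ∘ p) us)
    filter⁺ = Uniqueₚ.filter⁺ (T? ∘ p)
    restrict : ∀ {us vs} → (∀ {x} → T (p x) → x ∈ us → x ∈ vs) →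
      ∀ {x} → x ∈ filter (T? ∘ p) us → x ∈ filter (T? ∘ p) vs
    restrict f x∈ = let x∈us , px = ∈-filter⁻ (T? ∘ p) x∈ in ∈-filter⁺ (T? ∘ p) (f px x∈us) px

  concatMap-unique : ∀ {B : Set} {xs : List A} (f : A → List B) (retract : B → A) → Unique xs →
    (∀ {x} → x ∈ xs → Unique (f x)) → (∀ {x y} → x ∈ xs → y ∈ f x → retract y ≡ x) →
    Unique (concatMap f xs)
  concatMap-unique {xs = []}     f retract _            _  _ = []
  concatMap-unique {xs = x ∷ xs} f retract (x∉ ∷ uxs) uf rf =
    Uniqueₚ.++⁺ (uf (here refl)) (concatMap-unique f retract uxs (uf ∘ there) (rf ∘ there)) disjoint
    where
    disjoint : ∀ {y} → ¬ (y ∈ f x × y ∈ concatMap f xs)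
    disjoint (y∈fx , y∈rest) with x′ , x′∈xs , y∈fx′ ← find (∈-concatMap⁻ f {xs = xs} y∈rest) =
      All.lookup x∉ x′∈xs (trans (sym (rf (here refl) y∈fx)) (rf (there x′∈xs) y∈fx′))

countᵇ-interval-downFrom : ∀ a b m → countᵇ (inInterval a b) (downFrom m) ≡ (m ℕ.⊓ suc b) ∸ suc a
countᵇ-interval-downFrom a b zero = refl
countᵇ-interval-downFrom a b (suc m) with m ≤ᵇ b | ℕₚ.≤ᵇ-reflects-≤ m b
... | true  | ofʸ m≤b = begin
  (if (a <ᵇ m) ∧ true then 1 else 0) + countᵇ (inInterval a b) (downFrom m)
    ≡⟨ cong₂ (λ x k → (if x then 1 else 0) + k) (Boolₚ.∧-identityʳ (a <ᵇ m))
             (countᵇ-interval-downFrom a b m) ⟩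
  (if a <ᵇ m then 1 else 0) + ((m ℕ.⊓ suc b) ∸ suc a)
    ≡⟨ cong (λ k → _ + (k ∸ suc a)) (ℕₚ.m≤n⇒m⊓n≡m (ℕₚ.m≤n⇒m≤1+n m≤b)) ⟩
  (if a <ᵇ m then 1 else 0) + (m ∸ suc a)      ≡⟨ <ᵇ-indicator+∸ a m ⟩
  m ∸ a                                        ≡⟨ cong (_∸ a) (ℕₚ.m≤n⇒m⊓n≡m m≤b) ⟨
  (m ℕ.⊓ b) ∸ a                                ∎
  where open ≡-Reasoning
... | false | ofⁿ m≰b = begin
  (if (a <ᵇ m) ∧ false then 1 else 0) + countᵇ (inInterval a b) (downFrom m)
    ≡⟨ cong₂ (λ x k → (if x then 1 else 0) + k) (Boolₚ.∧-zeroʳ (a <ᵇ m))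
             (countᵇ-interval-downFrom a b m) ⟩
  (m ℕ.⊓ suc b) ∸ suc a  ≡⟨ cong (_∸ suc a) (ℕₚ.m≥n⇒m⊓n≡n b<m) ⟩
  b ∸ a                  ≡⟨ cong (_∸ a) (ℕₚ.m≥n⇒m⊓n≡n (ℕₚ.<⇒≤ b<m)) ⟨
  (m ℕ.⊓ b) ∸ a          ∎
  where
  open ≡-Reasoning
  b<m = ℕₚ.≰⇒> m≰b

countᵇ-interval-allFin : ∀ {n} a b → b ℕ.< n → countᵇ (inInterval a b ∘ toℕ) (allFin n) ≡ b ∸ a
countᵇ-interval-allFin {n} a b b<n = begin
  countᵇ (inInterval a b ∘ toℕ) (allFin n)   ≡⟨ countᵇ-map (inInterval a b) toℕ (allFin n) ⟨
  countᵇ (inInterval a b) (map toℕ (allFin n)) ≡⟨ countᵇ-↭ (inInterval a b) toℕ-allFin↭downFrom ⟩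
  countᵇ (inInterval a b) (downFrom n)       ≡⟨ countᵇ-interval-downFrom a b n ⟩
  (n ℕ.⊓ suc b) ∸ suc a                      ≡⟨ cong (_∸ suc a) (ℕₚ.m≥n⇒m⊓n≡n b<n) ⟩
  b ∸ a                                      ∎
  where
  open ≡-Reasoning
  toℕ-allFin↭downFrom : map toℕ (allFin n) ↭ downFrom n
  toℕ-allFin↭downFrom = unique-↭ (Uniqueₚ.map⁺ Finₚ.toℕ-injective (Uniqueₚ.allFin⁺ n)) (Uniqueₚ.downFrom⁺ n)
    (λ k∈ → let i , _ , k≡i = ∈-map⁻ toℕ k∈ in ∈-downFrom⁺ (subst (ℕ._< n) (sym k≡i) (Finₚ.toℕ<n i)))
    (λ k∈ → subst (_∈ map toℕ (allFin n)) (Finₚ.toℕ-fromℕ< (∈-downFrom⁻ k∈)) (∈-map⁺ toℕ (∈-allFin _)))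

allFin-↭ : ∀ {n} {w : List (Fin n)} → Unique w → length w ≡ n → w ↭ allFin n
allFin-↭ {n} {w} uw len = unique-↭ uw (Uniqueₚ.allFin⁺ n) (λ {x} _ → ∈-allFin x) covers
  where
  open import Data.List.Membership.DecPropositional Finₚ._≟_ using (_∈?_)
  covers : ∀ {x} → x ∈ allFin n → x ∈ w
  covers {x} _ with x ∈? w
  ... | yes x∈w = x∈w
  ... | no  x∉w = ⊥-elim $ ℕₚ.<-irrefl refl $ begin-strict
      length w                          ≡⟨ ↭ₚ.↭-length w↭ ⟩
      length (filter (_∈? w) (allFin n)) <⟨ Listₚ.filter-notAll (_∈? w) (allFin n) (lose (∈-allFin x) x∉w) ⟩
      length (allFin n)                 ≡⟨ Listₚ.length-tabulate id ⟩
      n                                 ≡⟨ len ⟨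
      length w                          ∎
    where
    open ℕₚ.≤-Reasoning
    w↭ : w ↭ filter (_∈? w) (allFin n)
    w↭ = unique-↭ uw (Uniqueₚ.filter⁺ (_∈? w) (Uniqueₚ.allFin⁺ n))
           (λ {y} y∈w → ∈-filter⁺ (_∈? w) (∈-allFin y) y∈w) (proj₂ ∘ ∈-filter⁻ (_∈? w) {xs = allFin n})

∀∈? : ∀ {A : Set} {P : A → Set} (xs : List A) → (∀ x → Dec (P x)) → Dec (∀ {x} → x ∈ xs → P x)
∀∈? xs P? = map′ All.lookup All.tabulate (All.all? P? xs)

Linked-delete : ∀ {A : Set} {R : A → A → Set} p {c q} → Linked R (p ++ c ∷ q) →
  (∀ {a b} → R a c → b ∈ q → R a b) → Linked R (p ++ q)
Linked-delete []                    lk          _      = Linked.tail lk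
Linked-delete (a ∷ [])     {q = []}    _           _      = [-]
Linked-delete (a ∷ [])     {q = b ∷ q} (a~c ∷ lk)  bridge = bridge a~c (here refl) ∷ Linked.tail lk
Linked-delete (a ∷ a′ ∷ p)             (a~a′ ∷ lk) bridge = a~a′ ∷ Linked-delete (a′ ∷ p) lk bridge

lastOf-∈ : ∀ {A : Set} (x : A) xs → lastOf x xs ∈ x ∷ xs
lastOf-∈ x []       = here refl
lastOf-∈ x (y ∷ ys) = there (lastOf-∈ y ys)

module _ {A : Set} {R : A → A → Set} where

  Linked-∷ʳ⁺ : ∀ x xs {y} → Linked R (x ∷ xs) → R (lastOf x xs) y → Linked R ((x ∷ xs) ++ [ y ])
  Linked-∷ʳ⁺ x []        _          r = r ∷ [-]
  Linked-∷ʳ⁺ x (x′ ∷ xs) (r ∷ path) r′ = r ∷ Linked-∷ʳ⁺ x′ xs path r′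

  Linked-∷ʳ⁻ : ∀ x xs {y} → Linked R ((x ∷ xs) ++ [ y ]) → Linked R (x ∷ xs) × R (lastOf x xs) y
  Linked-∷ʳ⁻ x []        (r ∷ [-])  = [-] , r
  Linked-∷ʳ⁻ x (x′ ∷ xs) (r ∷ path) = let path′ , r′ = Linked-∷ʳ⁻ x′ xs path in r ∷ path′ , r′

  Linked-split : ∀ u {m w} → Linked R (u ++ m ∷ w) → Linked R (u ++ [ m ]) × Linked R (m ∷ w)
  Linked-split []           path       = [-] , path
  Linked-split (a ∷ [])     (r ∷ path) = r ∷ [-] , path
  Linked-split (a ∷ a′ ∷ u) (r ∷ path) = let left , right = Linked-split (a′ ∷ u) path in r ∷ left , right

  Linked-join : ∀ u {m w} → Linked R (u ++ [ m ]) → Linked R (m ∷ w) → Linked R (u ++ m ∷ w)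
  Linked-join []           _           right = right
  Linked-join (a ∷ [])     (r ∷ [-])   right = r ∷ right
  Linked-join (a ∷ a′ ∷ u) (r ∷ left)  right = r ∷ Linked-join (a′ ∷ u) left right

  Linked-map∈ : ∀ {S : A → A → Set} {xs} →
    (∀ {a b} → a ∈ xs → b ∈ xs → R a b → S a b) → Linked R xs → Linked S xs
  Linked-map∈ f []         = []
  Linked-map∈ f [-]        = [-]
  Linked-map∈ f (r ∷ path) = f (here refl) (there (here refl)) r ∷ Linked-map∈ (λ a∈ b∈ → f (there a∈) (there b∈)) path

  rotate : ∀ {c x xs} → c ∈ x ∷ xs → Unique (x ∷ xs) → Linked R ((x ∷ xs) ++ [ x ]) →
    ∃ λ rest → Unique (c ∷ rest) × Linked R ((c ∷ rest) ++ [ c ])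
  rotate {c} {x} {xs} c∈ u cycle with ∈-∃++ c∈
  ... | []    , q , refl = xs , u , cycle
  ... | y ∷ p , q , refl = q ++ y ∷ p , Unique-resp-↭ (↭ₚ.++-comm (y ∷ p) (c ∷ q)) u , rotated
    where
    left×right = Linked-split (y ∷ p) (subst (Linked R) (Listₚ.++-assoc (y ∷ p) (c ∷ q) [ y ]) cycle)
    rotated : Linked R ((c ∷ q ++ y ∷ p) ++ [ c ])
    rotated = subst (Linked R) (cong (c ∷_) (sym (Listₚ.++-assoc q (y ∷ p) [ c ])))
                (Linked-join (c ∷ q) (proj₂ left×right) (proj₁ left×right))

allWords-length : ∀ {n} k {w : List (Fin n)} → w ∈ allWords n k → length w ≡ k
allWords-length zero    (here refl) = refl
allWords-length {n} (suc k) w∈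
  with w′ , w′∈ , w∈′ ← find (∈-concatMap⁻ (λ w → map (_∷ w) (allFin n)) {xs = allWords n k} w∈)
  with _ , _ , refl ← ∈-map⁻ (_∷ w′) w∈′ = cong suc (allWords-length k w′∈)

allWords-complete : ∀ {n} (w : List (Fin n)) → w ∈ allWords n (length w)
allWords-complete     []      = here refl
allWords-complete {n} (x ∷ w) =
  ∈-concatMap⁺ (λ w → map (_∷ w) (allFin n)) (lose (allWords-complete w) (∈-map⁺ (_∷ w) (∈-allFin x)))

allWords-unique : ∀ n k → Unique (allWords n k)
allWords-unique n zero    = [] ∷ []
allWords-unique n (suc k) =
  concatMap-unique (λ w → map (_∷ w) (allFin n)) (drop 1) (allWords-unique n k)
    (λ _ → Uniqueₚ.map⁺ Listₚ.∷-injectiveˡ (Uniqueₚ.allFin⁺ n))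
    (λ _ s∈ → let _ , _ , s≡ = ∈-map⁻ _ s∈ in cong (drop 1) s≡)

range : ℕ → ℕ → List ℕ
range s zero    = []
range s (suc m) = s ∷ range (suc s) m

module Sums {c ℓ : Level} (R : CommutativeSemiring c ℓ) where

  open CommutativeSemiring R public
    renaming (_+_ to _⊕_; _*_ to _⊗_; refl to ≈-refl; sym to ≈-sym; trans to ≈-trans)
  open Poly R public
  open import Relation.Binary.Reasoning.Setoid setoid

  private variable A B : Set

  sumL-cong : ∀ {f g : A → Carrier} xs → (∀ {x} → x ∈ xs → f x ≈ g x) → sumL f xs ≈ sumL g xs
  sumL-cong []       eq = ≈-refl
  sumL-cong (x ∷ xs) eq = +-cong (eq (here refl)) (sumL-cong xs (eq ∘ there))

  sumL-++ : ∀ (f : A → Carrier) xs ys → sumL f (xs ++ ys) ≈ sumL f xs ⊕ sumL f ys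
  sumL-++ f []       ys = ≈-sym (+-identityˡ _)
  sumL-++ f (x ∷ xs) ys = ≈-trans (+-congˡ (sumL-++ f xs ys)) (≈-sym (+-assoc _ _ _))

  sumL-map : ∀ (f : B → Carrier) (g : A → B) xs → sumL f (map g xs) ≡ sumL (f ∘ g) xs
  sumL-map f g []       = refl
  sumL-map f g (x ∷ xs) = cong (f (g x) ⊕_) (sumL-map f g xs)

  sumL-concatMap : ∀ (f : B → Carrier) (g : A → List B) xs →
    sumL f (concatMap g xs) ≈ sumL (sumL f ∘ g) xs
  sumL-concatMap f g []       = ≈-refl
  sumL-concatMap f g (x ∷ xs) = ≈-trans (sumL-++ f (g x) (concatMap g xs)) (+-congˡ (sumL-concatMap f g xs))

  sumL-*ˡ : ∀ a (f : A → Carrier) xs → sumL (λ x → a ⊗ f x) xs ≈ a ⊗ sumL f xs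
  sumL-*ˡ a f []       = ≈-sym (zeroʳ a)
  sumL-*ˡ a f (x ∷ xs) = ≈-trans (+-congˡ (sumL-*ˡ a f xs)) (≈-sym (distribˡ a _ _))

  sumL-*ʳ : ∀ a (f : A → Carrier) xs → sumL (λ x → f x ⊗ a) xs ≈ sumL f xs ⊗ a
  sumL-*ʳ a f xs = ≈-trans (sumL-cong xs (λ _ → *-comm _ _)) (≈-trans (sumL-*ˡ a f xs) (*-comm _ _))

  sumL-+ : ∀ (f g : A → Carrier) xs → sumL (λ x → f x ⊕ g x) xs ≈ sumL f xs ⊕ sumL g xs
  sumL-+ f g []       = ≈-sym (+-identityˡ _)
  sumL-+ f g (x ∷ xs) = ≈-trans (+-congˡ (sumL-+ f g xs)) (interchange _ _ _ _)
    where open import Algebra.Properties.CommutativeSemigroup +-commutativeSemigroup using (interchange)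

  sumL-↭ : ∀ (f : A → Carrier) {xs ys} → xs ↭ ys → sumL f xs ≈ sumL f ys
  sumL-↭ f ↭-id          = ≈-refl
  sumL-↭ f (prep x σ)    = +-congˡ (sumL-↭ f σ)
  sumL-↭ f (swap x y σ)  = begin
    f x ⊕ (f y ⊕ _) ≈⟨ +-assoc _ _ _ ⟨
    (f x ⊕ f y) ⊕ _ ≈⟨ +-cong (+-comm _ _) (sumL-↭ f σ) ⟩
    (f y ⊕ f x) ⊕ _ ≈⟨ +-assoc _ _ _ ⟩
    f y ⊕ (f x ⊕ _) ∎
  sumL-↭ f (↭-∘ σ τ)     = ≈-trans (sumL-↭ f σ) (sumL-↭ f τ)

  indicator : {P : Set} → Dec P → Carrier
  indicator (yes _) = 1#
  indicator (no _)  = 0#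

  indicator-yes : {P : Set} (P? : Dec P) → P → indicator P? ≈ 1#
  indicator-yes (yes _) _ = ≈-refl
  indicator-yes (no ¬p) p = ⊥-elim (¬p p)

  indicator-no : {P : Set} (P? : Dec P) → ¬ P → indicator P? ≈ 0#
  indicator-no (yes p) ¬p = ⊥-elim (¬p p)
  indicator-no (no _)  _  = ≈-refl

  indicator-cong : {P Q : Set} → (P → Q) → (Q → P) → (P? : Dec P) (Q? : Dec Q) → indicator P? ≈ indicator Q?
  indicator-cong to from (yes p) Q? = ≈-sym (indicator-yes Q? (to p))
  indicator-cong to from (no ¬p) Q? = ≈-sym (indicator-no Q? (¬p ∘ from))

  indicator-× : {P Q : Set} (P? : Dec P) (Q? : Dec Q) (PQ? : Dec (P × Q)) → indicator PQ? ≈ indicator P? ⊗ indicator Q?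
  indicator-× (yes p) (yes q) PQ? = ≈-trans (indicator-yes PQ? (p , q)) (≈-sym (*-identityˡ 1#))
  indicator-× (yes _) (no ¬q) PQ? = ≈-trans (indicator-no PQ? (¬q ∘ proj₂)) (≈-sym (zeroʳ 1#))
  indicator-× (no ¬p) Q?      PQ? = ≈-trans (indicator-no PQ? (¬p ∘ proj₁)) (≈-sym (zeroˡ _))

  sumL-filter : ∀ {P : A → Set} (P? : Decidable P) (f : A → Carrier) xs →
    sumL f (filter P? xs) ≈ sumL (λ x → indicator (P? x) ⊗ f x) xs
  sumL-filter P? f []       = ≈-refl
  sumL-filter P? f (x ∷ xs) with P? x
  ... | yes _ = +-cong (≈-sym (*-identityˡ _)) (sumL-filter P? f xs)
  ... | no  _ = ≈-trans (sumL-filter P? f xs) (≈-trans (≈-sym (+-identityˡ _)) (+-congʳ (≈-sym (zeroˡ _))))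

  pow-+ : ∀ t a b → pow t (a + b) ≈ pow t a ⊗ pow t b
  pow-+ t zero    b = ≈-sym (*-identityˡ _)
  pow-+ t (suc a) b = ≈-trans (*-congˡ (pow-+ t a b)) (≈-sym (*-assoc _ _ _))

  qint-+ : ∀ t a b → qint t (a + b) ≈ qint t a ⊕ pow t a ⊗ qint t b
  qint-+ t zero    b = ≈-sym (≈-trans (+-identityˡ _) (*-identityˡ _))
  qint-+ t (suc a) b = begin
    1# ⊕ t ⊗ qint t (a + b)                          ≈⟨ +-congˡ (*-congˡ (qint-+ t a b)) ⟩
    1# ⊕ t ⊗ (qint t a ⊕ pow t a ⊗ qint t b)          ≈⟨ +-congˡ (distribˡ _ _ _) ⟩
    1# ⊕ (t ⊗ qint t a ⊕ t ⊗ (pow t a ⊗ qint t b))    ≈⟨ +-assoc _ _ _ ⟨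
    (1# ⊕ t ⊗ qint t a) ⊕ t ⊗ (pow t a ⊗ qint t b)    ≈⟨ +-congˡ (*-assoc _ _ _) ⟨
    (1# ⊕ t ⊗ qint t a) ⊕ (t ⊗ pow t a) ⊗ qint t b    ∎

  sumL-pow-range : ∀ t s m → sumL (pow t) (range s m) ≈ pow t s ⊗ qint t m
  sumL-pow-range t s zero    = ≈-sym (zeroʳ _)
  sumL-pow-range t s (suc m) = begin
    pow t s ⊕ sumL (pow t) (range (suc s) m)  ≈⟨ +-congˡ (sumL-pow-range t (suc s) m) ⟩
    pow t s ⊕ (t ⊗ pow t s) ⊗ qint t m         ≈⟨ +-cong (≈-sym (*-identityʳ _)) (≈-trans (*-congʳ (*-comm _ _)) (*-assoc _ _ _)) ⟩
    pow t s ⊗ 1# ⊕ pow t s ⊗ (t ⊗ qint t m)    ≈⟨ distribˡ _ _ _ ⟨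
    pow t s ⊗ (1# ⊕ t ⊗ qint t m)              ∎

module HessenbergFactor {c ℓ : Level} (R : CommutativeSemiring c ℓ) (t : CommutativeSemiring.Carrier R)
                       {n : ℕ} (h : Fin n → Fin n) where
  open Poly R

  factor : Fin n → CommutativeSemiring.Carrier R
  factor i = qint t (toℕ (h i) ∸ toℕ i + 1)

UpperSegment : ∀ {n} → List (Fin n) → Set
UpperSegment cs = Linked Fin._<_ cs × (∀ {x y} → x ∈ cs → x Fin.≤ y → y ∈ cs)

module _ {n : ℕ} {c : Fin n} {cs : List (Fin n)} where

  upperSegment-below : UpperSegment (c ∷ cs) → All (c Fin.<_) cs
  upperSegment-below ([-]       , _) = []
  upperSegment-below (c<x ∷ inc , _) = Linkedₚ.Linked⇒All Finₚ.<-trans c<x inc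

  upperSegment-above : ∀ {x} → UpperSegment (c ∷ cs) → c Fin.< x → x ∈ cs
  upperSegment-above (_ , up) c<x with up (here refl) (ℕₚ.<⇒≤ c<x)
  ... | here refl = ⊥-elim (Finₚ.<-irrefl refl c<x)
  ... | there x∈  = x∈

  upperSegment-tail : UpperSegment (c ∷ cs) → UpperSegment cs
  upperSegment-tail seg@(inc , _) =
    Linked.tail inc ,
    λ x∈ x≤y → upperSegment-above seg (ℕₚ.<-≤-trans (All.lookup (upperSegment-below seg) x∈) x≤y)

upperSegment-unique : ∀ {n} {cs : List (Fin n)} → UpperSegment cs → Unique cs
upperSegment-unique (inc , _) = AllPairs.map Finₚ.<⇒≢ (Linkedₚ.Linked⇒AllPairs Finₚ.<-trans inc)

allFin-increasing : ∀ n → Linked Fin._<_ (allFin n)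
allFin-increasing zero          = []
allFin-increasing (suc zero)    = [-]
allFin-increasing (suc (suc n)) =
  ℕ.z<s ∷ subst (Linked Fin._<_) (Listₚ.map-tabulate id Fin.suc)
                (Linkedₚ.map⁺ (Linked.map ℕ.s<s (allFin-increasing (suc n))))

allFin-upperSegment : ∀ {n} → UpperSegment (allFin n)
allFin-upperSegment {n} = allFin-increasing n , λ _ _ → ∈-allFin _

labellings : {A : Set} → List A → List (List (A × Bool))
labellings []      = [ [] ]
labellings (e ∷ E) = concatMap (λ z → ((e , false) ∷ z) ∷ ((e , true) ∷ z) ∷ []) (labellings E)

labellings-proj₁ : ∀ {A : Set} (E : List A) {z} → z ∈ labellings E → map proj₁ z ≡ E
labellings-proj₁ []      (here refl) = refl
labellings-proj₁ (e ∷ E) z∈ with find (∈-concatMap⁻ _ {xs = labellings E} z∈)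
... | z′ , z′∈ , here refl         = cong (e ∷_) (labellings-proj₁ E z′∈)
... | z′ , z′∈ , there (here refl) = cong (e ∷_) (labellings-proj₁ E z′∈)

module _ {A : Set} where

  labelled⁻ : ∀ {E} {z : List (A × Bool)} {e b} → map proj₁ z ≡ E → (e , b) ∈ z → e ∈ E
  labelled⁻ refl eb∈ = ∈-map⁺ proj₁ eb∈

  labelled⁺ : ∀ {E} {z : List (A × Bool)} {e} → map proj₁ z ≡ E → e ∈ E → ∃ λ b → (e , b) ∈ z
  labelled⁺ refl e∈ with (e , b) , eb∈ , refl ← ∈-map⁻ proj₁ e∈ = b , eb∈

  labelled-functional : ∀ {z : List (A × Bool)} {e b b′} →
    Unique (map proj₁ z) → (e , b) ∈ z → (e , b′) ∈ z → b ≡ b′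
  labelled-functional {_ ∷ z} _         (here refl) (here refl) = refl
  labelled-functional {_ ∷ z} (e∉ ∷ _)  (here refl) (there m)   = ⊥-elim (All.lookup e∉ (∈-map⁺ proj₁ m) refl)
  labelled-functional {_ ∷ z} (e∉ ∷ _)  (there m)   (here refl) = ⊥-elim (All.lookup e∉ (∈-map⁺ proj₁ m) refl)
  labelled-functional {_ ∷ z} (_ ∷ u)   (there m)   (there m′)  = labelled-functional u m m′

  take-length-++ : ∀ (xs ys : List A) → take (length xs) (xs ++ ys) ≡ xs
  take-length-++ []       ys = refl
  take-length-++ (x ∷ xs) ys = cong (x ∷_) (take-length-++ xs ys)

  drop-length-++ : ∀ (xs ys : List A) → drop (length xs) (xs ++ ys) ≡ ys
  drop-length-++ []       ys = refl
  drop-length-++ (x ∷ xs) ys = drop-length-++ xs ys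

  labelling-++⁻ : ∀ (M : List A) {E} {z : List (A × Bool)} → map proj₁ z ≡ M ++ E →
    map proj₁ (take (length M) z) ≡ M × map proj₁ (drop (length M) z) ≡ E
  labelling-++⁻ M {E} {z} labels =
    trans (sym (Listₚ.take-map (length M) z)) (trans (cong (take (length M)) labels) (take-length-++ M E)) ,
    trans (sym (Listₚ.drop-map (length M) z)) (trans (cong (drop (length M)) labels) (drop-length-++ M E))

trues : {A : Set} → List (A × Bool) → ℕ
trues = countᵇ proj₂

module _ {c ℓ : Level} (R : CommutativeSemiring c ℓ) where
  open Sums R
  open import Relation.Binary.Reasoning.Setoid setoid

  sum-labellings-++ : ∀ {A : Set} (M E : List A) (G : List (A × Bool) → Carrier) →
    sumL G (labellings (M ++ E)) ≈ sumL (λ z₂ → sumL (λ z₁ → G (z₁ ++ z₂)) (labellings M)) (labellings E)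
  sum-labellings-++ []      E G = sumL-cong (labellings E) (λ _ → ≈-sym (+-identityʳ _))
  sum-labellings-++ {A} (e ∷ M) E G = begin
    sumL G (concatMap extend (labellings (M ++ E)))
      ≈⟨ sumL-concatMap G extend (labellings (M ++ E)) ⟩
    sumL (sumL G ∘ extend) (labellings (M ++ E))
      ≈⟨ sum-labellings-++ M E (sumL G ∘ extend) ⟩
    sumL (λ z₂ → sumL (λ z₁ → sumL G (extend (z₁ ++ z₂))) (labellings M)) (labellings E)
      ≈⟨ sumL-cong (labellings E) (λ _ → ≈-sym (sumL-concatMap _ extend (labellings M))) ⟩
    sumL (λ z₂ → sumL (λ z₁ → G (z₁ ++ z₂)) (concatMap extend (labellings M))) (labellings E) ∎
    where
    extend : List (A × Bool) → List (List (A × Bool))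
    extend z = ((e , false) ∷ z) ∷ ((e , true) ∷ z) ∷ []

module Downsets {V : Set} (_≟_ : DecidableEquality V) {_≺_ : V → V → Set} (_≺?_ : ∀ a b → Dec (a ≺ b)) where

  Chosen : List (V × Bool) → V → Set
  Chosen z k = (k , true) ∈ z

  chosen? : ∀ z k → Dec (Chosen z k)
  chosen? z k = any? (≡-dec _≟_ Boolₚ._≟_ (k , true)) z

  DownClosed : List V → List (V × Bool) → Set
  DownClosed M z = ∀ {j} → j ∈ M → ∀ {k} → k ∈ M → Chosen z j → k ≺ j → Chosen z k

  Between : List V → (V → Bool) → (V → Bool) → List (V × Bool) → Set
  Between M Lo Hi z =
    DownClosed M z × (∀ {k} → k ∈ M → T (Lo k) → Chosen z k) × (∀ {k} → k ∈ M → Chosen z k → T (Hi k))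

  between? : ∀ M Lo Hi z → Dec (Between M Lo Hi z)
  between? M Lo Hi z =
    ∀∈? M (λ j → ∀∈? M (λ k → chosen? z j →-dec (k ≺? j →-dec chosen? z k)))
    ×-dec ∀∈? M (λ k → T? (Lo k) →-dec chosen? z k)
    ×-dec ∀∈? M (λ k → chosen? z k →-dec T? (Hi k))

  between-cong : ∀ {M Lo Hi Lo′ Hi′ z} → (∀ {k} → k ∈ M → Lo k ≡ Lo′ k) → (∀ {k} → k ∈ M → Hi k ≡ Hi′ k) →
    Between M Lo Hi z → Between M Lo′ Hi′ z
  between-cong lo≡ hi≡ (down , lo , hi) =
    down , (λ k∈ → lo k∈ ∘ subst T (sym (lo≡ k∈))) , (λ k∈ → subst T (hi≡ k∈) ∘ hi k∈)

  DownClosedᵇ : List V → (V → Bool) → Set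
  DownClosedᵇ M D = ∀ {j k} → j ∈ M → k ∈ M → T (D j) → k ≺ j → T (D k)

  record Bounds (M : List V) (Lo Hi : V → Bool) : Set where
    field
      lo-closed : DownClosedᵇ M Lo
      hi-closed : DownClosedᵇ M Hi
      lo⊆hi     : ∀ {k} → k ∈ M → T (Lo k) → T (Hi k)

  record StrictTotalOn (M : List V) : Set where
    field
      compare : ∀ {a b} → a ∈ M → b ∈ M → a ≢ b → a ≺ b ⊎ b ≺ a
      asym    : ∀ {a b} → a ∈ M → b ∈ M → a ≺ b → ¬ b ≺ a
      ≺-trans : ∀ {a b d} → a ∈ M → b ∈ M → d ∈ M → a ≺ b → b ≺ d → a ≺ d

  strictTotalOn-tail : ∀ {j M} → StrictTotalOn (j ∷ M) → StrictTotalOn M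
  strictTotalOn-tail ord = record
    { compare = λ a∈ b∈ → compare (there a∈) (there b∈)
    ; asym    = λ a∈ b∈ → asym (there a∈) (there b∈)
    ; ≺-trans = λ a∈ b∈ d∈ → ≺-trans (there a∈) (there b∈) (there d∈)
    }
    where open StrictTotalOn ord

  below : V → V → Bool
  below j k = ⌊ k ≺? j ⌋

  below⁺ : ∀ {j k} → k ≺ j → T (below j k)
  below⁺ = fromWitness

  below⁻ : ∀ {j k} → T (below j k) → k ≺ j
  below⁻ = toWitness

  -- Choosing j forces everything below j to be chosen; skipping it forbids everything above j.
  module Extend {j M} {z : List (V × Bool)} (j∉M : j ∉ M) (labels : map proj₁ z ≡ M) where

    chosen⇒∈ : ∀ {k} → Chosen z k → k ∈ M
    chosen⇒∈ k∈ = subst (_ ∈_) labels (∈-map⁺ proj₁ k∈)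

    chosen-∷ : ∀ {b k} → Chosen ((j , b) ∷ z) k → (k ≡ j × b ≡ true) ⊎ Chosen z k
    chosen-∷ (here refl) = inj₁ (refl , refl)
    chosen-∷ (there k∈)  = inj₂ k∈

    chosen-∷-∈ : ∀ {b k} → k ∈ M → Chosen ((j , b) ∷ z) k → Chosen z k
    chosen-∷-∈ k∈M k∈ with chosen-∷ k∈
    ... | inj₁ (refl , _) = ⊥-elim (j∉M k∈M)
    ... | inj₂ k∈z        = k∈z

    unchosen : ¬ Chosen ((j , false) ∷ z) j
    unchosen j∈ with chosen-∷ j∈
    ... | inj₂ j∈z = j∉M (chosen⇒∈ j∈z)

    choose⇒ : ∀ {Lo Hi} → Between (j ∷ M) Lo Hi ((j , true) ∷ z) →
      T (Hi j) × Between M (λ k → Lo k ∨ below j k) Hi z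
    choose⇒ {Lo} (down , lo , hi) =
      hi (here refl) (here refl) ,
      (λ j∈ k∈ j∈z k≺j → chosen-∷-∈ k∈ (down (there j∈) (there k∈) (there j∈z) k≺j)) ,
      lo′ ,
      (λ k∈ k∈z → hi (there k∈) (there k∈z))
      where
      lo′ : ∀ {k} → k ∈ M → T (Lo k ∨ below j k) → Chosen z k
      lo′ {k} k∈ lo∨below with T-∨⁻ {Lo k} lo∨below
      ... | inj₁ lo-k    = chosen-∷-∈ k∈ (lo (there k∈) lo-k)
      ... | inj₂ below-k = chosen-∷-∈ k∈ (down (here refl) (there k∈) (here refl) (below⁻ below-k))

    choose⇐ : ∀ {Lo Hi} → T (Hi j) → Between M (λ k → Lo k ∨ below j k) Hi z →
      Between (j ∷ M) Lo Hi ((j , true) ∷ z)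
    choose⇐ {Lo} {Hi} hi-j (down , lo , hi) = down′ , lo′ , hi′
      where
      down′ : DownClosed (j ∷ M) ((j , true) ∷ z)
      down′ _         (here refl) _   _   = here refl
      down′ {i} _ {k} (there k∈)  i∈z k≺i with chosen-∷ i∈z
      ... | inj₁ (refl , _) = there (lo k∈ (T-∨⁺ʳ (Lo k) (below⁺ k≺i)))
      ... | inj₂ i∈z′       = there (down (chosen⇒∈ i∈z′) k∈ i∈z′ k≺i)
      lo′ : ∀ {k} → k ∈ j ∷ M → T (Lo k) → Chosen ((j , true) ∷ z) k
      lo′ (here refl) _    = here refl
      lo′ (there k∈)  lo-k = there (lo k∈ (T-∨⁺ˡ (below j _) lo-k))
      hi′ : ∀ {k} → k ∈ j ∷ M → Chosen ((j , true) ∷ z) k → T (Hi k)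
      hi′ _ k∈z with chosen-∷ k∈z
      ... | inj₁ (refl , _) = hi-j
      ... | inj₂ k∈z′       = hi (chosen⇒∈ k∈z′) k∈z′

    skip⇒ : ∀ {Lo Hi} → StrictTotalOn (j ∷ M) → Between (j ∷ M) Lo Hi ((j , false) ∷ z) →
      ¬ T (Lo j) × Between M Lo (λ k → Hi k ∧ below j k) z
    skip⇒ {Lo} {Hi} ord (down , lo , hi) =
      unchosen ∘ lo (here refl) ,
      (λ j∈ k∈ j∈z k≺j → chosen-∷-∈ k∈ (down (there j∈) (there k∈) (there j∈z) k≺j)) ,
      (λ k∈ lo-k → chosen-∷-∈ k∈ (lo (there k∈) lo-k)) ,
      hi′
      where
      hi′ : ∀ {k} → k ∈ M → Chosen z k → T (Hi k ∧ below j k)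
      hi′ k∈ k∈z with StrictTotalOn.compare ord (there k∈) (here refl) (λ { refl → j∉M k∈ })
      ... | inj₁ k≺j = T-∧⁺ (hi (there k∈) (there k∈z)) (below⁺ k≺j)
      ... | inj₂ j≺k = ⊥-elim (unchosen (down (there k∈) (here refl) (there k∈z) j≺k))

    skip⇐ : ∀ {Lo Hi} → StrictTotalOn (j ∷ M) → ¬ T (Lo j) → Between M Lo (λ k → Hi k ∧ below j k) z →
      Between (j ∷ M) Lo Hi ((j , false) ∷ z)
    skip⇐ {Lo} {Hi} ord ¬lo-j (down , lo , hi) = down′ , lo′ , hi′
      where
      hi-below : ∀ {k} → Chosen z k → T (Hi k) × k ≺ j
      hi-below {k} k∈z with T-∧⁻ {Hi k} (hi (chosen⇒∈ k∈z) k∈z)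
      ... | hi-k , below-k = hi-k , below⁻ below-k
      down′ : DownClosed (j ∷ M) ((j , false) ∷ z)
      down′ i∈ k∈ i∈z k≺i with chosen-∷ i∈z | k∈
      ... | inj₂ i∈z′ | here refl =
        ⊥-elim (StrictTotalOn.asym ord (here refl) (there (chosen⇒∈ i∈z′)) k≺i (proj₂ (hi-below i∈z′)))
      ... | inj₂ i∈z′ | there k∈′ = there (down (chosen⇒∈ i∈z′) k∈′ i∈z′ k≺i)
      lo′ : ∀ {k} → k ∈ j ∷ M → T (Lo k) → Chosen ((j , false) ∷ z) k
      lo′ (here refl) lo-j = ⊥-elim (¬lo-j lo-j)
      lo′ (there k∈)  lo-k = there (lo k∈ lo-k)
      hi′ : ∀ {k} → k ∈ j ∷ M → Chosen ((j , false) ∷ z) k → T (Hi k)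
      hi′ _ k∈z with chosen-∷ k∈z
      ... | inj₂ k∈z′ = proj₁ (hi-below k∈z′)

  bounds-tail : ∀ {j M Lo Hi} → Bounds (j ∷ M) Lo Hi → Bounds M Lo Hi
  bounds-tail b = record
    { lo-closed = λ j∈ k∈ → lo-closed (there j∈) (there k∈)
    ; hi-closed = λ j∈ k∈ → hi-closed (there j∈) (there k∈)
    ; lo⊆hi     = lo⊆hi ∘ there
    }
    where open Bounds b

  module _ {c ℓ : Level} (R : CommutativeSemiring c ℓ) (t : CommutativeSemiring.Carrier R) where
    open Sums R
    open import Relation.Binary.Reasoning.Setoid setoid

    weight : List V → (V → Bool) → (V → Bool) → List (V × Bool) → Carrier
    weight M Lo Hi z = indicator (between? M Lo Hi z) ⊗ pow t (trues z)

    powSum : ℕ → ℕ → Carrier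
    powSum a b = pow t a ⊗ qint t (suc (b ∸ a))

    powSum-split : ∀ {a r b} → a ℕ.≤ r → r ℕ.≤ b → powSum a r ⊕ t ⊗ powSum r b ≈ powSum a (suc b)
    powSum-split {a} {r} {b} a≤r r≤b = begin
      pow t a ⊗ qint t (suc d₁) ⊕ t ⊗ (pow t r ⊗ qint t (suc d₂))
        ≈⟨ +-congˡ (*-congˡ (*-congʳ (≈-trans (reflexive (cong (pow t) (sym (ℕₚ.m+[n∸m]≡n a≤r))))
                                               (pow-+ t a d₁)))) ⟩
      pow t a ⊗ qint t (suc d₁) ⊕ t ⊗ ((pow t a ⊗ pow t d₁) ⊗ qint t (suc d₂))
        ≈⟨ +-congˡ (≈-trans (*-congˡ (*-assoc _ _ _))
                            (≈-trans (x∙yz≈y∙xz t (pow t a) _) (*-congˡ (≈-sym (*-assoc _ _ _))))) ⟩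
      pow t a ⊗ qint t (suc d₁) ⊕ pow t a ⊗ (pow t (suc d₁) ⊗ qint t (suc d₂))
        ≈⟨ distribˡ _ _ _ ⟨
      pow t a ⊗ (qint t (suc d₁) ⊕ pow t (suc d₁) ⊗ qint t (suc d₂))
        ≈⟨ *-congˡ (qint-+ t (suc d₁) (suc d₂)) ⟨
      pow t a ⊗ qint t (suc d₁ + suc d₂)
        ≡⟨ cong (λ k → pow t a ⊗ qint t k) lengths ⟩
      pow t a ⊗ qint t (suc (suc b ∸ a)) ∎
      where
      d₁ = r ∸ a ; d₂ = b ∸ r
      open import Algebra.Properties.CommutativeSemigroup *-commutativeSemigroup using (x∙yz≈y∙xz)
      lengths : suc d₁ + suc d₂ ≡ suc (suc b ∸ a)
      lengths = cong suc (trans (ℕₚ.+-suc d₁ d₂)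
        (trans (cong suc ([n∸m]+[o∸n]≡o∸m a≤r r≤b)) (sym (ℕₚ.+-∸-assoc 1 (ℕₚ.≤-trans a≤r r≤b)))))

    weight-cong : ∀ {M Lo Hi Lo′ Hi′} z → (∀ {k} → k ∈ M → Lo k ≡ Lo′ k) → (∀ {k} → k ∈ M → Hi k ≡ Hi′ k) →
      weight M Lo Hi z ≈ weight M Lo′ Hi′ z
    weight-cong {M} {Lo} {Hi} {Lo′} {Hi′} z lo≡ hi≡ = *-congʳ $
      indicator-cong (between-cong lo≡ hi≡) (between-cong (sym ∘ lo≡) (sym ∘ hi≡))
                     (between? M Lo Hi z) (between? M Lo′ Hi′ z)

    module _ {j M} {z : List (V × Bool)} (j∉M : j ∉ M) (labels : map proj₁ z ≡ M) {Lo Hi : V → Bool} where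
      open Extend j∉M labels
      open import Algebra.Properties.CommutativeSemigroup *-commutativeSemigroup using (x∙yz≈y∙xz)

      weight-choose : T (Hi j) → weight (j ∷ M) Lo Hi ((j , true) ∷ z) ≈ t ⊗ weight M (λ k → Lo k ∨ below j k) Hi z
      weight-choose hi-j = ≈-trans
        (*-congʳ (indicator-cong (proj₂ ∘ choose⇒ {Lo} {Hi}) (choose⇐ {Lo} hi-j) (between? _ _ _ _) (between? _ _ _ _)))
        (x∙yz≈y∙xz _ t _)

      weight-choose-¬ : ¬ T (Hi j) → weight (j ∷ M) Lo Hi ((j , true) ∷ z) ≈ 0#
      weight-choose-¬ ¬hi-j =
        ≈-trans (*-congʳ (indicator-no (between? _ _ _ _) (¬hi-j ∘ proj₁ ∘ choose⇒ {Lo} {Hi}))) (zeroˡ _)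

      weight-skip : StrictTotalOn (j ∷ M) → ¬ T (Lo j) →
        weight (j ∷ M) Lo Hi ((j , false) ∷ z) ≈ weight M Lo (λ k → Hi k ∧ below j k) z
      weight-skip ord ¬lo-j =
        *-congʳ (indicator-cong (proj₂ ∘ skip⇒ {Lo} {Hi} ord) (skip⇐ {Lo} {Hi} ord ¬lo-j) (between? _ _ _ _) (between? _ _ _ _))

      weight-skip-¬ : StrictTotalOn (j ∷ M) → T (Lo j) → weight (j ∷ M) Lo Hi ((j , false) ∷ z) ≈ 0#
      weight-skip-¬ ord lo-j =
        ≈-trans (*-congʳ (indicator-no (between? _ _ _ _) (λ b → proj₁ (skip⇒ {Lo} {Hi} ord b) lo-j))) (zeroˡ _)

    SumFormula : List V → (V → Bool) → (V → Bool) → Set ℓ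
    SumFormula M Lo Hi = sumL (weight M Lo Hi) (labellings M) ≈ powSum (countᵇ Lo M) (countᵇ Hi M)

    module InductionStep {j M} (uM : Unique (j ∷ M)) (ord : StrictTotalOn (j ∷ M))
                         (IH : ∀ {Lo Hi} → Bounds M Lo Hi → SumFormula M Lo Hi)
                         {Lo Hi} (bounds : Bounds (j ∷ M) Lo Hi) where

      open Bounds bounds

      j∉M : j ∉ M
      j∉M = Uniqueₚ.Unique[x∷xs]⇒x∉xs uM

      labels : ∀ {z} → z ∈ labellings M → map proj₁ z ≡ M
      labels = labellings-proj₁ M

      summand : List (V × Bool) → Carrier
      summand z = weight (j ∷ M) Lo Hi ((j , false) ∷ z) ⊕ (weight (j ∷ M) Lo Hi ((j , true) ∷ z) ⊕ 0#)

      sum-∷ : sumL (weight (j ∷ M) Lo Hi) (labellings (j ∷ M)) ≈ sumL summand (labellings M)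
      sum-∷ = sumL-concatMap (weight (j ∷ M) Lo Hi) (λ z → ((j , false) ∷ z) ∷ ((j , true) ∷ z) ∷ []) (labellings M)

      above-excluded : ∀ {D k} → DownClosedᵇ (j ∷ M) D → ¬ T (D j) → k ∈ M → T (D k) → T (below j k)
      above-excluded closed ¬d-j k∈ d-k with StrictTotalOn.compare ord (there k∈) (here refl) (λ { refl → j∉M k∈ })
      ... | inj₁ k≺j = below⁺ k≺j
      ... | inj₂ j≺k = ⊥-elim (¬d-j (closed (there k∈) (here refl) d-k j≺k))

      below-closed : DownClosedᵇ M (below j)
      below-closed i∈ k∈ below-i k≺i =
        below⁺ (StrictTotalOn.≺-trans ord (there k∈) (there i∈) (here refl) k≺i (below⁻ below-i))

      forced-in : T (Lo j) → SumFormula (j ∷ M) Lo Hi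
      forced-in lo-j = begin
        sumL (weight (j ∷ M) Lo Hi) (labellings (j ∷ M))   ≈⟨ sum-∷ ⟩
        sumL summand (labellings M)                        ≈⟨ sumL-cong (labellings M) summand≈ ⟩
        sumL (λ z → t ⊗ weight M Lo Hi z) (labellings M)   ≈⟨ sumL-*ˡ t (weight M Lo Hi) (labellings M) ⟩
        t ⊗ sumL (weight M Lo Hi) (labellings M)           ≈⟨ *-congˡ (IH (bounds-tail bounds)) ⟩
        t ⊗ powSum (countᵇ Lo M) (countᵇ Hi M)             ≈⟨ *-assoc _ _ _ ⟨
        powSum (suc (countᵇ Lo M)) (suc (countᵇ Hi M))     ≡⟨ cong₂ powSum (countᵇ-∷-T M lo-j) (countᵇ-∷-T M hi-j) ⟨
        powSum (countᵇ Lo (j ∷ M)) (countᵇ Hi (j ∷ M))     ∎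
        where
        hi-j : T (Hi j)
        hi-j = lo⊆hi (here refl) lo-j
        summand≈ : ∀ {z} → z ∈ labellings M → summand z ≈ t ⊗ weight M Lo Hi z
        summand≈ {z} z∈ = begin
          summand z                                       ≈⟨ +-cong (weight-skip-¬ j∉M (labels z∈) ord lo-j) (+-identityʳ _) ⟩
          0# ⊕ weight (j ∷ M) Lo Hi ((j , true) ∷ z)      ≈⟨ +-identityˡ _ ⟩
          weight (j ∷ M) Lo Hi ((j , true) ∷ z)           ≈⟨ weight-choose j∉M (labels z∈) hi-j ⟩
          t ⊗ weight M (λ k → Lo k ∨ below j k) Hi z      ≈⟨ *-congˡ (weight-cong z lo≡ (λ _ → refl)) ⟩
          t ⊗ weight M Lo Hi z                            ∎
          where
          lo≡ : ∀ {k} → k ∈ M → Lo k ∨ below j k ≡ Lo k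
          lo≡ k∈ = ∨-≡ˡ (λ below-k → lo-closed (here refl) (there k∈) lo-j (below⁻ below-k))

      forced-out : ¬ T (Hi j) → SumFormula (j ∷ M) Lo Hi
      forced-out ¬hi-j = begin
        sumL (weight (j ∷ M) Lo Hi) (labellings (j ∷ M))   ≈⟨ sum-∷ ⟩
        sumL summand (labellings M)                        ≈⟨ sumL-cong (labellings M) summand≈ ⟩
        sumL (weight M Lo Hi) (labellings M)               ≈⟨ IH (bounds-tail bounds) ⟩
        powSum (countᵇ Lo M) (countᵇ Hi M)                 ≡⟨ cong₂ powSum (countᵇ-∷-¬T M ¬lo-j) (countᵇ-∷-¬T M ¬hi-j) ⟨
        powSum (countᵇ Lo (j ∷ M)) (countᵇ Hi (j ∷ M))     ∎
        where
        ¬lo-j : ¬ T (Lo j)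
        ¬lo-j = ¬hi-j ∘ lo⊆hi (here refl)
        summand≈ : ∀ {z} → z ∈ labellings M → summand z ≈ weight M Lo Hi z
        summand≈ {z} z∈ = begin
          summand z                                       ≈⟨ +-cong (weight-skip j∉M (labels z∈) ord ¬lo-j)
                                                                    (≈-trans (+-identityʳ _) (weight-choose-¬ j∉M (labels z∈) ¬hi-j)) ⟩
          weight M Lo (λ k → Hi k ∧ below j k) z ⊕ 0#     ≈⟨ +-identityʳ _ ⟩
          weight M Lo (λ k → Hi k ∧ below j k) z          ≈⟨ weight-cong z (λ _ → refl) hi≡ ⟩
          weight M Lo Hi z                                ∎
          where
          hi≡ : ∀ {k} → k ∈ M → Hi k ∧ below j k ≡ Hi k
          hi≡ k∈ = ∧-≡ˡ (above-excluded hi-closed ¬hi-j k∈)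

      free : ¬ T (Lo j) → T (Hi j) → SumFormula (j ∷ M) Lo Hi
      free ¬lo-j hi-j = begin
        sumL (weight (j ∷ M) Lo Hi) (labellings (j ∷ M))
          ≈⟨ sum-∷ ⟩
        sumL summand (labellings M)
          ≈⟨ sumL-cong (labellings M) summand≈ ⟩
        sumL (λ z → weight M Lo (below j) z ⊕ t ⊗ weight M (below j) Hi z) (labellings M)
          ≈⟨ sumL-+ _ _ (labellings M) ⟩
        sumL (weight M Lo (below j)) (labellings M) ⊕ sumL (λ z → t ⊗ weight M (below j) Hi z) (labellings M)
          ≈⟨ +-cong (IH lower) (≈-trans (sumL-*ˡ t _ (labellings M)) (*-congˡ (IH upper))) ⟩
        powSum (countᵇ Lo M) r ⊕ t ⊗ powSum r (countᵇ Hi M)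
          ≈⟨ powSum-split (countᵇ-mono M lo⇒below) (countᵇ-mono M below⇒hi) ⟩
        powSum (countᵇ Lo M) (suc (countᵇ Hi M))
          ≡⟨ cong₂ powSum (countᵇ-∷-¬T M ¬lo-j) (countᵇ-∷-T M hi-j) ⟨
        powSum (countᵇ Lo (j ∷ M)) (countᵇ Hi (j ∷ M)) ∎
        where
        r = countᵇ (below j) M
        lo⇒below : ∀ {k} → k ∈ M → T (Lo k) → T (below j k)
        lo⇒below = above-excluded lo-closed ¬lo-j
        below⇒hi : ∀ {k} → k ∈ M → T (below j k) → T (Hi k)
        below⇒hi k∈ below-k = hi-closed (here refl) (there k∈) hi-j (below⁻ below-k)
        lower : Bounds M Lo (below j)
        lower = record { lo-closed = Bounds.lo-closed (bounds-tail bounds) ; hi-closed = below-closed ; lo⊆hi = lo⇒below }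
        upper : Bounds M (below j) Hi
        upper = record { lo-closed = below-closed ; hi-closed = Bounds.hi-closed (bounds-tail bounds) ; lo⊆hi = below⇒hi }
        summand≈ : ∀ {z} → z ∈ labellings M → summand z ≈ weight M Lo (below j) z ⊕ t ⊗ weight M (below j) Hi z
        summand≈ {z} z∈ = +-cong
          (≈-trans (weight-skip j∉M (labels z∈) ord ¬lo-j)
                   (weight-cong z (λ _ → refl) (λ k∈ → ∧-≡ʳ (below⇒hi k∈))))
          (≈-trans (+-identityʳ _)
            (≈-trans (weight-choose j∉M (labels z∈) hi-j)
                     (*-congˡ (weight-cong z (λ k∈ → ∨-≡ʳ (lo⇒below k∈)) (λ _ → refl)))))

      sum-weight-∷ : SumFormula (j ∷ M) Lo Hi
      sum-weight-∷ = cases (T? (Lo j)) (T? (Hi j))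
        where
        cases : Dec (T (Lo j)) → Dec (T (Hi j)) → SumFormula (j ∷ M) Lo Hi
        cases (yes lo-j) _          = forced-in lo-j
        cases (no _)     (no ¬hi-j) = forced-out ¬hi-j
        cases (no ¬lo-j) (yes hi-j) = free ¬lo-j hi-j

    sum-weight : ∀ M {Lo Hi} → Unique M → StrictTotalOn M → Bounds M Lo Hi → SumFormula M Lo Hi
    sum-weight [] {Lo} {Hi} _ _ _ = begin
      weight [] Lo Hi [] ⊕ 0#                 ≈⟨ +-identityʳ _ ⟩
      indicator (between? [] Lo Hi []) ⊗ 1#   ≈⟨ *-identityʳ _ ⟩
      indicator (between? [] Lo Hi [])        ≈⟨ indicator-yes (between? [] Lo Hi []) ((λ ()) , (λ ()) , (λ ())) ⟩
      1#                                      ≈⟨ ≈-trans (*-identityˡ _) (≈-trans (+-congˡ (zeroʳ t)) (+-identityʳ 1#)) ⟨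
      1# ⊗ (1# ⊕ t ⊗ 0#)                      ∎
    sum-weight (j ∷ M) uM ord bounds = InductionStep.sum-weight-∷ uM ord
      (sum-weight M (Unique.tail uM) (strictTotalOn-tail ord)) bounds

module Inversions {n : ℕ} (h : Fin n → Fin n) where

  canPrecede : Fin n → Fin n → Bool
  canPrecede c b = toℕ b ≤ᵇ toℕ (h c)

  invPair : Fin n → List (Fin n) → Fin n → Bool
  invPair a rest b = (toℕ a <ᵇ toℕ b) ∧ followCond h b rest

  -- crossInv pre w counts the h-inversions (a , b) with a in w and b in pre.
  crossInv : List (Fin n) → List (Fin n) → ℕ
  crossInv pre []         = 0
  crossInv pre (a ∷ rest) = countᵇ (invPair a rest) pre + crossInv pre rest

  crossInv-++ : ∀ P Q r → crossInv (P ++ Q) r ≡ crossInv P r + crossInv Q r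
  crossInv-++ P Q []       = refl
  crossInv-++ P Q (a ∷ r) = begin
    countᵇ p (P ++ Q) + crossInv (P ++ Q) r                     ≡⟨ cong₂ _+_ (countᵇ-++ p P Q) (crossInv-++ P Q r) ⟩
    (countᵇ p P + countᵇ p Q) + (crossInv P r + crossInv Q r)   ≡⟨ interchange (countᵇ p P) (countᵇ p Q) _ _ ⟩
    (countᵇ p P + crossInv P r) + (countᵇ p Q + crossInv Q r)   ∎
    where
    open ≡-Reasoning
    open import Algebra.Properties.CommutativeSemigroup ℕₚ.+-commutativeSemigroup using (interchange)
    p = invPair a r

  invAux≡crossInv+inv : ∀ P r → invAux h P r ≡ crossInv P r + inv h r
  invAux≡crossInv+inv P []       = refl
  invAux≡crossInv+inv P (a ∷ r) = begin
    countᵇ p P + invAux h (P ++ [ a ]) r                       ≡⟨ cong (countᵇ p P +_) (invAux≡crossInv+inv (P ++ [ a ]) r) ⟩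
    countᵇ p P + (crossInv (P ++ [ a ]) r + inv h r)           ≡⟨ cong (λ k → countᵇ p P + (k + inv h r)) (crossInv-++ P [ a ] r) ⟩
    countᵇ p P + ((crossInv P r + crossInv [ a ] r) + inv h r) ≡⟨ regroup (countᵇ p P) (crossInv P r) (crossInv [ a ] r) (inv h r) ⟩
    (countᵇ p P + crossInv P r) + (crossInv [ a ] r + inv h r) ≡⟨ cong ((countᵇ p P + crossInv P r) +_) (invAux≡crossInv+inv [ a ] r) ⟨
    (countᵇ p P + crossInv P r) + invAux h [ a ] r             ∎
    where
    open ≡-Reasoning
    p = invPair a r
    regroup : ∀ a b c d → a + ((b + c) + d) ≡ (a + b) + (c + d)
    regroup = solve-∀

  crossInv-below : ∀ {c} r → All (c Fin.<_) r → crossInv [ c ] r ≡ 0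
  crossInv-below []       _              = refl
  crossInv-below {c} (a ∷ r) (c<a ∷ c<r) with toℕ a <ᵇ toℕ c | ℕₚ.<ᵇ-reflects-< (toℕ a) (toℕ c)
  ... | true  | ofʸ a<c = ⊥-elim (ℕₚ.<-asym a<c c<a)
  ... | false | _       = crossInv-below r c<r

  invAux-∷ʳ-below : ∀ {c} P r → All (c Fin.<_) r → invAux h (P ++ [ c ]) r ≡ invAux h P r
  invAux-∷ʳ-below {c} P r c<r = begin
    invAux h (P ++ [ c ]) r                        ≡⟨ invAux≡crossInv+inv (P ++ [ c ]) r ⟩
    crossInv (P ++ [ c ]) r + inv h r              ≡⟨ cong (_+ inv h r) (crossInv-++ P [ c ] r) ⟩
    (crossInv P r + crossInv [ c ] r) + inv h r    ≡⟨ cong (λ k → (crossInv P r + k) + inv h r) (crossInv-below r c<r) ⟩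
    (crossInv P r + 0) + inv h r                   ≡⟨ cong (_+ inv h r) (ℕₚ.+-identityʳ _) ⟩
    crossInv P r + inv h r                         ≡⟨ invAux≡crossInv+inv P r ⟨
    invAux h P r                                   ∎
    where open ≡-Reasoning

  followCond-≤ : ∀ {b x r} → TymCond h (x ∷ r) → b Fin.≤ x → followCond h b r ≡ true
  followCond-≤ [-]         b≤x = refl
  followCond-≤ (x⊑y ∷ _)  b≤x = T⇒≡true (ℕₚ.≤⇒≤ᵇ (ℕₚ.≤-trans b≤x x⊑y))

  inv-insertAfterHead : ∀ {c x r} P → All (c Fin.<_) P → All (c Fin.<_) (x ∷ r) → TymCond h (x ∷ r) → x Fin.≤ h c →
    invAux h P (x ∷ c ∷ r) ≡ invAux h P (x ∷ r) + suc (countᵇ (canPrecede c) P)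
  inv-insertAfterHead {c} {x} {r} P c<P (c<x ∷ c<r) tym x⊑c = begin
    A + (countᵇ (invPair c r) (P ++ [ x ]) + invAux h ((P ++ [ x ]) ++ [ c ]) r)
      ≡⟨ cong₂ (λ k l → A + (k + l)) (countᵇ-++ (invPair c r) P [ x ]) (invAux-∷ʳ-below (P ++ [ x ]) r c<r) ⟩
    A + ((countᵇ (invPair c r) P + countᵇ (invPair c r) [ x ]) + I)
      ≡⟨ cong₂ (λ k l → A + ((k + l) + I)) c-below-P c-below-x ⟩
    A + ((F + 1) + I)   ≡⟨ arith₁ A F I ⟩
    (A + F) + suc I     ≡⟨ cong (_+ suc I) (countᵇ-interchange P exchange) ⟩
    (B + K) + suc I     ≡⟨ arith₂ B K I ⟩
    (B + I) + suc K     ∎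
    where
    open ≡-Reasoning
    A = countᵇ (invPair x (c ∷ r)) P
    B = countᵇ (invPair x r) P
    F = countᵇ (λ b → followCond h b r) P
    K = countᵇ (canPrecede c) P
    I = invAux h (P ++ [ x ]) r
    c-below-P : countᵇ (invPair c r) P ≡ F
    c-below-P = countᵇ-cong P (λ {b} b∈P → cong (_∧ followCond h b r) (T⇒≡true (ℕₚ.<⇒<ᵇ (All.lookup c<P b∈P))))
    c-below-x : countᵇ (invPair c r) [ x ] ≡ 1
    c-below-x rewrite T⇒≡true (ℕₚ.<⇒<ᵇ c<x) | followCond-≤ tym (ℕₚ.≤-refl {toℕ x}) = refl
    exchange : ∀ {b} → b ∈ P →
      (if invPair x (c ∷ r) b then 1 else 0) + (if followCond h b r then 1 else 0) ≡
      (if invPair x r b then 1 else 0) + (if canPrecede c b then 1 else 0)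
    exchange {b} _ with toℕ x <ᵇ toℕ b | ℕₚ.<ᵇ-reflects-< (toℕ x) (toℕ b)
    ... | true  | _       = ℕₚ.+-comm (if canPrecede c b then 1 else 0) _
    ... | false | ofⁿ x≮b = cong (λ β → if β then 1 else 0)
      (trans (followCond-≤ tym b≤x) (sym (T⇒≡true (ℕₚ.≤⇒≤ᵇ (ℕₚ.≤-trans b≤x x⊑c)))))
      where b≤x = ℕₚ.≮⇒≥ x≮b
    arith₁ : ∀ a f i → a + ((f + 1) + i) ≡ (a + f) + suc i
    arith₁ = solve-∀
    arith₂ : ∀ b k i → (b + k) + suc i ≡ (b + i) + suc k
    arith₂ = solve-∀

  -- For c smaller than every letter of w only the letter in front of c can violate the Tymoczko condition.
  laterInsertions : Fin n → List (Fin n) → List (List (Fin n))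
  laterInsertions c []      = []
  laterInsertions c (x ∷ r) =
    if canPrecede c x then (x ∷ c ∷ r) ∷ map (x ∷_) (laterInsertions c r) else map (x ∷_) (laterInsertions c r)

  insertions : Fin n → List (Fin n) → List (List (Fin n))
  insertions c w = (c ∷ w) ∷ laterInsertions c w

  laterInsertions-∷ : ∀ {c x r s} → s ∈ laterInsertions c (x ∷ r) →
    ∃ λ s′ → s′ ∈ insertions c r × s ≡ x ∷ s′
  laterInsertions-∷ {c} {x} {r} s∈ with canPrecede c x
  ... | true  = case s∈ of λ where
    (here refl) → _ , here refl , refl
    (there s∈′) → let s′ , s′∈ , s≡ = map∷⁻ s∈′ in s′ , there s′∈ , s≡
  ... | false = let s′ , s′∈ , s≡ = map∷⁻ s∈ in s′ , there s′∈ , s≡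

  inv-∷-laterInsertions : ∀ {c} P x r ks →
    map (invAux h (P ++ [ x ])) (laterInsertions c r) ≡ map (invAux h (P ++ [ x ]) r +_) ks →
    map (invAux h P) (map (x ∷_) (laterInsertions c r)) ≡ map (invAux h P (x ∷ r) +_) ks
  inv-∷-laterInsertions P x [] []      _  = refl
  inv-∷-laterInsertions P x [] (_ ∷ _) ()
  inv-∷-laterInsertions {c} P x r@(y ∷ r′) ks eq = begin
    map (invAux h P) (map (x ∷_) L)                      ≡⟨ Listₚ.map-∘ L ⟨
    map (λ s → invAux h P (x ∷ s)) L                     ≡⟨ Listₚ.map-cong-local (All.tabulate shift) ⟩
    map (λ s → B + invAux h (P ++ [ x ]) s) L            ≡⟨ Listₚ.map-∘ L ⟩
    map (B +_) (map (invAux h (P ++ [ x ])) L)           ≡⟨ cong (map (B +_)) eq ⟩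
    map (B +_) (map (invAux h (P ++ [ x ]) r +_) ks)     ≡⟨ Listₚ.map-∘ ks ⟨
    map (λ k → B + (invAux h (P ++ [ x ]) r + k)) ks     ≡⟨ Listₚ.map-cong (λ k → sym (ℕₚ.+-assoc B _ k)) ks ⟩
    map (invAux h P (x ∷ r) +_) ks                       ∎
    where
    open ≡-Reasoning
    L = laterInsertions c r
    B = countᵇ (invPair x r) P
    shift : ∀ {s} → s ∈ L → invAux h P (x ∷ s) ≡ B + invAux h (P ++ [ x ]) s
    shift s∈ with _ , _ , refl ← laterInsertions-∷ {c} {y} {r′} s∈ = refl

  LaterInversions : Fin n → List (Fin n) → List (Fin n) → ℕ → Set
  LaterInversions c P w K =
    map (invAux h P) (laterInsertions c w) ≡ map (invAux h P w +_) (range (suc K) (countᵇ (canPrecede c) w))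

  laterInsertions-inv : ∀ c P w → All (c Fin.<_) P → All (c Fin.<_) w → TymCond h w →
    LaterInversions c P w (countᵇ (canPrecede c) P)
  laterInsertions-inv c P []      _   _                     _   = refl
  laterInsertions-inv c P (x ∷ r) c<P c<w@(c<x ∷ c<r) tym
    with laterInsertions-inv c (P ++ [ x ]) r (Allₚ.++⁺ c<P (c<x ∷ [])) c<r (Linked.tail tym)
       | countᵇ-++ (canPrecede c) P [ x ]
  ... | IH | count-P∷ʳx with toℕ x ≤ᵇ toℕ (h c) | ℕₚ.≤ᵇ-reflects-≤ (toℕ x) (toℕ (h c))
  ... | true  | ofʸ x⊑c = cong₂ _∷_ (inv-insertAfterHead P c<P c<w tym x⊑c)
    (inv-∷-laterInsertions P x r _ (subst (LaterInversions c (P ++ [ x ]) r) (trans count-P∷ʳx (ℕₚ.+-comm _ 1)) IH))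
  ... | false | ofⁿ _   =
    inv-∷-laterInsertions P x r _ (subst (LaterInversions c (P ++ [ x ]) r) (trans count-P∷ʳx (ℕₚ.+-identityʳ _)) IH)

  insertions-inv : ∀ {c w} → All (c Fin.<_) w → TymCond h w →
    map (inv h) (insertions c w) ≡ map (inv h w +_) (range 0 (suc (countᵇ (canPrecede c) w)))
  insertions-inv {c} {w} c<w tym =
    cong₂ _∷_ (trans (invAux-∷ʳ-below [] w c<w) (sym (ℕₚ.+-identityʳ _))) (laterInsertions-inv c [] w [] c<w tym)

  module _ {c ℓ : Level} (R : CommutativeSemiring c ℓ) (t : CommutativeSemiring.Carrier R) where
    open Sums R
    open import Relation.Binary.Reasoning.Setoid setoid

    sum-insertions : ∀ {c w} → All (c Fin.<_) w → TymCond h w →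
      sumL (pow t ∘ inv h) (insertions c w) ≈ pow t (inv h w) ⊗ qint t (suc (countᵇ (canPrecede c) w))
    sum-insertions {c} {w} c<w tym = begin
      sumL (pow t ∘ inv h) (insertions c w)        ≡⟨ sumL-map (pow t) (inv h) (insertions c w) ⟨
      sumL (pow t) (map (inv h) (insertions c w))  ≡⟨ cong (sumL (pow t)) (insertions-inv c<w tym) ⟩
      sumL (pow t) (map (inv h w +_) ks)           ≡⟨ sumL-map (pow t) (inv h w +_) ks ⟩
      sumL (λ k → pow t (inv h w + k)) ks          ≈⟨ sumL-cong ks (λ {k} _ → pow-+ t (inv h w) k) ⟩
      sumL (λ k → pow t (inv h w) ⊗ pow t k) ks    ≈⟨ sumL-*ˡ (pow t (inv h w)) (pow t) ks ⟩
      pow t (inv h w) ⊗ sumL (pow t) ks            ≈⟨ *-congˡ (sumL-pow-range t 0 (suc m)) ⟩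
      pow t (inv h w) ⊗ (1# ⊗ qint t (suc m))      ≈⟨ *-congˡ (*-identityˡ _) ⟩
      pow t (inv h w) ⊗ qint t (suc m)             ∎
      where
      m = countᵇ (canPrecede c) w
      ks = range 0 (suc m)

  insertions-↭ : ∀ {c w s} → s ∈ insertions c w → s ↭ c ∷ w
  insertions-↭         (here refl)  = ↭-refl
  insertions-↭ {w = []} (there ())
  insertions-↭ {c} {x ∷ r} (there s∈) with _ , s′∈ , refl ← laterInsertions-∷ {c} {x} {r} s∈ =
    ↭-trans (prep x (insertions-↭ s′∈)) (swap x c ↭-refl)

  erase : Fin n → List (Fin n) → List (Fin n)
  erase c = filter (λ x → ¬? (x Finₚ.≟ c))

  insertions-erase : ∀ {c w s} → c ∉ w → s ∈ insertions c w → erase c s ≡ w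
  insertions-erase {c} {w} c∉w (here refl) =
    trans (Listₚ.filter-reject (λ x → ¬? (x Finₚ.≟ c)) (λ c≢c → c≢c refl))
          (Listₚ.filter-all (λ x → ¬? (x Finₚ.≟ c)) (Allₚ.¬Any⇒All¬ w (c∉w ∘ Any.map sym)))
  insertions-erase {w = []} c∉w (there ())
  insertions-erase {c} {x ∷ r} c∉w (there s∈) with s′ , s′∈ , refl ← laterInsertions-∷ {c} {x} {r} s∈ =
    trans (Listₚ.filter-accept (λ x → ¬? (x Finₚ.≟ c)) (λ x≡c → c∉w (here (sym x≡c))))
          (cong (x ∷_) (insertions-erase (c∉w ∘ there) s′∈))

  front∉laterInsertions : ∀ {c w r} → c ∉ w → c ∷ r ∉ laterInsertions c w
  front∉laterInsertions {c} {x ∷ w} c∉w s∈ with _ , _ , c∷r≡ ← laterInsertions-∷ {c} {x} {w} s∈ =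
    c∉w (here (Listₚ.∷-injectiveˡ c∷r≡))

  laterInsertions-unique : ∀ {c w} → c ∉ w → Unique (laterInsertions c w)
  laterInsertions-unique {c} {[]}    _   = []
  laterInsertions-unique {c} {x ∷ r} c∉w with canPrecede c x
  ... | true  = Allₚ.¬Any⇒All¬ _ (front∉laterInsertions (c∉w ∘ there) ∘ proj₂ ∘ map∷-decomp∈) ∷
                Uniqueₚ.map⁺ Listₚ.∷-injectiveʳ (laterInsertions-unique (c∉w ∘ there))
  ... | false = Uniqueₚ.map⁺ Listₚ.∷-injectiveʳ (laterInsertions-unique (c∉w ∘ there))

  insertions-unique : ∀ {c w} → c ∉ w → Unique (insertions c w)
  insertions-unique c∉w = Allₚ.¬Any⇒All¬ _ (front∉laterInsertions c∉w) ∷ laterInsertions-unique c∉w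

  insertions-complete : ∀ {c} p {q} → TymCond h (p ++ c ∷ q) → p ++ c ∷ q ∈ insertions c (p ++ q)
  insertions-complete []      _   = here refl
  insertions-complete (x ∷ p) tym = there (later p tym)
    where
    later : ∀ {c x} p {q} → TymCond h (x ∷ p ++ c ∷ q) → x ∷ p ++ c ∷ q ∈ laterInsertions c (x ∷ p ++ q)
    later {c} {x} [] (x⊑c ∷ _) with toℕ x ≤ᵇ toℕ (h c) | ℕₚ.≤ᵇ-reflects-≤ (toℕ x) (toℕ (h c))
    ... | true  | _       = here refl
    ... | false | ofⁿ x⋢c = ⊥-elim (x⋢c x⊑c)
    later {c} {x} (y ∷ p) (_ ∷ tym) with canPrecede c x
    ... | true  = there (∈-map⁺ (x ∷_) (later p tym))
    ... | false = ∈-map⁺ (x ∷_) (later p tym)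

  tymoczkoWords : List (Fin n) → List (List (Fin n))
  tymoczkoWords []       = [ [] ]
  tymoczkoWords (c ∷ cs) = concatMap (insertions c) (tymoczkoWords cs)

  module _ (wi : WeaklyIncreasing h) (ex : Extensive h) where

    ∷-TymCond : ∀ {c w} → All (c Fin.<_) w → TymCond h w → TymCond h (c ∷ w)
    ∷-TymCond []          _   = [-]
    ∷-TymCond (c<y ∷ _) tym = ℕₚ.≤-trans (ℕₚ.<⇒≤ c<y) (ex _) ∷ tym

    ∷-laterInsertions-TymCond : ∀ {c x r s} → All (c Fin.<_) (x ∷ r) → TymCond h (x ∷ r) →
      s ∈ map (x ∷_) (laterInsertions c r) → TymCond h s
    laterInsertions-TymCond : ∀ {c w s} → All (c Fin.<_) w → TymCond h w → s ∈ laterInsertions c w → TymCond h s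
    laterInsertions-TymCond {c} {x ∷ r} c<w tym s∈
      with toℕ x ≤ᵇ toℕ (h c) | ℕₚ.≤ᵇ-reflects-≤ (toℕ x) (toℕ (h c))
    ... | true  | ofʸ x⊑c with s∈
    ...   | here refl  = x⊑c ∷ ∷-TymCond (All.tail c<w) (Linked.tail tym)
    ...   | there s∈′  = ∷-laterInsertions-TymCond c<w tym s∈′
    laterInsertions-TymCond {c} {x ∷ r} c<w tym s∈
        | false | _    = ∷-laterInsertions-TymCond c<w tym s∈

    ∷-laterInsertions-TymCond {c} {x} {y ∷ r} c<w tym s∈
      with s′ , s′∈ , refl ← map∷⁻ s∈
      with _ , _ , refl ← laterInsertions-∷ {c} {y} {r} s′∈ =
      Linked.head tym ∷ laterInsertions-TymCond (All.tail c<w) (Linked.tail tym) s′∈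

    insertions-TymCond : ∀ {c w s} → All (c Fin.<_) w → TymCond h w → s ∈ insertions c w → TymCond h s
    insertions-TymCond c<w tym (here refl) = ∷-TymCond c<w tym
    insertions-TymCond c<w tym (there s∈)  = laterInsertions-TymCond c<w tym s∈

    tymoczkoWords-sound : ∀ {cs w} → UpperSegment cs → w ∈ tymoczkoWords cs → w ↭ cs × TymCond h w
    tymoczkoWords-sound {[]}     _   (here refl) = ↭-refl , []
    tymoczkoWords-sound {c ∷ cs} seg w∈
      with w′ , w′∈ , w∈′ ← find (∈-concatMap⁻ (insertions c) {xs = tymoczkoWords cs} w∈)
      with w′↭ , tym′ ← tymoczkoWords-sound (upperSegment-tail seg) w′∈ =
      ↭-trans (insertions-↭ w∈′) (prep c w′↭) ,
      insertions-TymCond (↭ₚ.All-resp-↭ (↭-sym w′↭) (upperSegment-below seg)) tym′ w∈′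

    tymoczkoWords-complete : ∀ {cs w} → UpperSegment cs → w ↭ cs → TymCond h w → w ∈ tymoczkoWords cs
    tymoczkoWords-complete {[]}     _   σ _   with refl ← ↭ₚ.↭-empty-inv σ = here refl
    tymoczkoWords-complete {c ∷ cs} seg σ tym
      with p , q , refl ← ∈-∃++ (↭ₚ.∈-resp-↭ (↭-sym σ) (here refl)) =
      ∈-concatMap⁺ (insertions c) (lose pq∈ (insertions-complete p tym))
      where
      pq↭ : p ++ q ↭ cs
      pq↭ = ↭ₚ.drop-mid p [] σ
      c<q : ∀ {b} → b ∈ q → c Fin.< b
      c<q b∈q = All.lookup (upperSegment-below seg) (↭ₚ.∈-resp-↭ pq↭ (∈-++⁺ʳ p b∈q))
      pq∈ : p ++ q ∈ tymoczkoWords cs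
      pq∈ = tymoczkoWords-complete (upperSegment-tail seg) pq↭
              (Linked-delete p tym (λ a⊑c b∈q → ℕₚ.≤-trans a⊑c (wi c _ (ℕₚ.<⇒≤ (c<q b∈q)))))

    tymoczkoWords-unique : ∀ {cs} → UpperSegment cs → Unique (tymoczkoWords cs)
    tymoczkoWords-unique {[]}     _   = [] ∷ []
    tymoczkoWords-unique {c ∷ cs} seg =
      concatMap-unique (insertions c) (erase c) (tymoczkoWords-unique (upperSegment-tail seg))
        (λ w∈ → insertions-unique (c∉ w∈)) (λ w∈ → insertions-erase (c∉ w∈))
      where
      c∉ : ∀ {w} → w ∈ tymoczkoWords cs → c ∉ w
      c∉ w∈ c∈w = Finₚ.<-irrefl refl
        (All.lookup (upperSegment-below seg) (↭ₚ.∈-resp-↭ (proj₁ (tymoczkoWords-sound (upperSegment-tail seg) w∈)) c∈w))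

    tymoczkoConfigs-↭ : tymoczkoConfigs h ↭ tymoczkoWords (allFin n)
    tymoczkoConfigs-↭ =
      unique-↭ (Uniqueₚ.filter⁺ (isTymoczko? h) (allWords-unique n n)) (tymoczkoWords-unique allFin-upperSegment) to from
      where
      to : ∀ {w} → w ∈ tymoczkoConfigs h → w ∈ tymoczkoWords (allFin n)
      to w∈ with w∈all , uw , tym ← ∈-filter⁻ (isTymoczko? h) {xs = allWords n n} w∈ =
        tymoczkoWords-complete allFin-upperSegment (allFin-↭ uw (allWords-length n w∈all)) tym
      from : ∀ {w} → w ∈ tymoczkoWords (allFin n) → w ∈ tymoczkoConfigs h
      from {w} w∈ with σ , tym ← tymoczkoWords-sound allFin-upperSegment w∈ =
        ∈-filter⁺ (isTymoczko? h) (subst (λ k → w ∈ allWords n k) len (allWords-complete w))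
          (Unique-resp-↭ (↭-sym σ) (Uniqueₚ.allFin⁺ n) , tym)
        where
        len : length w ≡ n
        len = trans (↭ₚ.↭-length σ) (Listₚ.length-tabulate id)

    count-canPrecede : ∀ {c cs} → UpperSegment (c ∷ cs) → countᵇ (canPrecede c) cs ≡ toℕ (h c) ∸ toℕ c
    count-canPrecede {c} {cs} seg = begin
      countᵇ (canPrecede c) cs              ≡⟨ countᵇ-cong cs (λ {x} x∈ → cong (_∧ canPrecede c x) (c<ᵇx x∈)) ⟨
      countᵇ (inInterval c′ hc ∘ toℕ) cs    ≡⟨ countᵇ-support (inInterval c′ hc ∘ toℕ) cs-unique (Uniqueₚ.allFin⁺ n)
                                                 (λ _ _ → ∈-allFin _) (λ px _ → upperSegment-above seg (above px)) ⟩
      countᵇ (inInterval c′ hc ∘ toℕ) (allFin n) ≡⟨ countᵇ-interval-allFin c′ hc (Finₚ.toℕ<n (h c)) ⟩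
      hc ∸ c′                               ∎
      where
      open ≡-Reasoning
      c′ = toℕ c ; hc = toℕ (h c)
      c<ᵇx : ∀ {x} → x ∈ cs → (c′ <ᵇ toℕ x) ≡ true
      c<ᵇx x∈ = T⇒≡true (ℕₚ.<⇒<ᵇ (All.lookup (upperSegment-below seg) x∈))
      above : ∀ {x} → T (inInterval c′ hc (toℕ x)) → c Fin.< x
      above {x} px = ℕₚ.<ᵇ⇒< _ _ (proj₁ (T-∧⁻ {c′ <ᵇ toℕ x} px))
      cs-unique : Unique cs
      cs-unique = upperSegment-unique (upperSegment-tail seg)

    module _ {c ℓ : Level} (R : CommutativeSemiring c ℓ) (t : CommutativeSemiring.Carrier R) where
      open Sums R
      open HessenbergFactor R t h
      open import Relation.Binary.Reasoning.Setoid setoid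

      sum-tymoczkoWords : ∀ {cs} → UpperSegment cs → sumL (pow t ∘ inv h) (tymoczkoWords cs) ≈ prodL factor cs
      sum-tymoczkoWords {[]}     _   = +-identityʳ _
      sum-tymoczkoWords {c ∷ cs} seg = begin
        sumL (pow t ∘ inv h) (concatMap (insertions c) (tymoczkoWords cs))
          ≈⟨ sumL-concatMap (pow t ∘ inv h) (insertions c) (tymoczkoWords cs) ⟩
        sumL (sumL (pow t ∘ inv h) ∘ insertions c) (tymoczkoWords cs)
          ≈⟨ sumL-cong _ step ⟩
        sumL (λ w → factor c ⊗ pow t (inv h w)) (tymoczkoWords cs)
          ≈⟨ sumL-*ˡ (factor c) (pow t ∘ inv h) (tymoczkoWords cs) ⟩
        factor c ⊗ sumL (pow t ∘ inv h) (tymoczkoWords cs)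
          ≈⟨ *-congˡ (sum-tymoczkoWords (upperSegment-tail seg)) ⟩
        factor c ⊗ prodL factor cs ∎
        where
        step : ∀ {w} → w ∈ tymoczkoWords cs → sumL (pow t ∘ inv h) (insertions c w) ≈ factor c ⊗ pow t (inv h w)
        step {w} w∈ with w↭ , tym ← tymoczkoWords-sound (upperSegment-tail seg) w∈ = begin
          sumL (pow t ∘ inv h) (insertions c w)                   ≈⟨ sum-insertions R t c<w tym ⟩
          pow t (inv h w) ⊗ qint t (suc (countᵇ (canPrecede c) w)) ≡⟨ cong (λ k → pow t (inv h w) ⊗ qint t k) count ⟩
          pow t (inv h w) ⊗ factor c                               ≈⟨ *-comm _ _ ⟩
          factor c ⊗ pow t (inv h w)                               ∎
          where
          c<w : All (c Fin.<_) w
          c<w = ↭ₚ.All-resp-↭ (↭-sym w↭) (upperSegment-below seg)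
          count : suc (countᵇ (canPrecede c) w) ≡ toℕ (h c) ∸ toℕ c + 1
          count = trans (cong suc (trans (countᵇ-↭ (canPrecede c) w↭) (count-canPrecede seg))) (ℕₚ.+-comm 1 _)

      sum-tymoczkoConfigs : sumL (pow t ∘ inv h) (tymoczkoConfigs h) ≈ prodL factor (allFin n)
      sum-tymoczkoConfigs = ≈-trans (sumL-↭ _ tymoczkoConfigs-↭) (sum-tymoczkoWords allFin-upperSegment)

-- Defs.edges filters with a function local to its where-block.  Unifying with the meta neighboursIn names that
-- function; abstracting allFin n keeps the unification problem in the pattern fragment.
mutual
  neighboursIn : ∀ {n} → (Fin n → Fin n) → Fin n → List (Fin n) → List (Fin n)
  neighboursIn = _

  edges≡ : ∀ {n} (h : Fin n → Fin n) →
    edges h ≡ concatMap (λ i → map (i ,_) (neighboursIn h i (allFin n))) (allFin n)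
  edges≡ {n} h with allFin n
  ... | xs = refl

module Orientations {n : ℕ} (h : Fin n → Fin n) where

  adjacentᵇ : Fin n → Fin n → Bool
  adjacentᵇ i j = inInterval (toℕ i) (toℕ (h i)) (toℕ j)

  upperNeighbours : Fin n → List (Fin n)
  upperNeighbours i = filter (T? ∘ adjacentᵇ i) (allFin n)

  neighboursIn≡filter : ∀ i xs → neighboursIn h i xs ≡ filter (T? ∘ adjacentᵇ i) xs
  neighboursIn≡filter i []       = refl
  neighboursIn≡filter i (x ∷ xs) with adjacentᵇ i x
  ... | true  = cong (x ∷_) (neighboursIn≡filter i xs)
  ... | false = neighboursIn≡filter i xs

  Edge : Set
  Edge = Fin n × Fin n

  star : Fin n → List Edge
  star c = map (c ,_) (upperNeighbours c)

  stars : List (Fin n) → List Edge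
  stars = concatMap star

  edges≡stars : edges h ≡ stars (allFin n)
  edges≡stars = trans (edges≡ h)
    (Listₚ.concatMap-cong (λ i → cong (map (i ,_)) (neighboursIn≡filter i (allFin n))) (allFin n))

  upperNeighbours⁻ : ∀ {i j} → j ∈ upperNeighbours i → i Fin.< j × j Fin.≤ h i
  upperNeighbours⁻ {i} {j} j∈ with _ , adj ← ∈-filter⁻ (T? ∘ adjacentᵇ i) {xs = allFin n} j∈
    with i<ᵇj , j≤ᵇhi ← T-∧⁻ {toℕ i <ᵇ toℕ j} adj = ℕₚ.<ᵇ⇒< _ _ i<ᵇj , ℕₚ.≤ᵇ⇒≤ _ _ j≤ᵇhi

  upperNeighbours⁺ : ∀ {i j} → i Fin.< j → j Fin.≤ h i → j ∈ upperNeighbours i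
  upperNeighbours⁺ {i} i<j j≤hi =
    ∈-filter⁺ (T? ∘ adjacentᵇ i) (∈-allFin _) (T-∧⁺ (ℕₚ.<⇒<ᵇ i<j) (ℕₚ.≤⇒≤ᵇ j≤hi))

  star⁻ : ∀ {c e} → e ∈ star c → ∃ λ k → e ≡ (c , k) × k ∈ upperNeighbours c
  star⁻ e∈ = let k , k∈ , e≡ = ∈-map⁻ _ e∈ in k , e≡ , k∈

  star⁺ : ∀ {c k} → k ∈ upperNeighbours c → (c , k) ∈ star c
  star⁺ = ∈-map⁺ _

  star-unique : ∀ c → Unique (star c)
  star-unique c = Uniqueₚ.map⁺ (cong proj₂) (Uniqueₚ.filter⁺ (T? ∘ adjacentᵇ c) (Uniqueₚ.allFin⁺ n))

  length-star : ∀ c → length (star c) ≡ toℕ (h c) ∸ toℕ c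
  length-star c = begin
    length (star c)                             ≡⟨ Listₚ.length-map _ (upperNeighbours c) ⟩
    length (upperNeighbours c)                  ≡⟨ countᵇ≡length-filter (adjacentᵇ c) (allFin n) ⟨
    countᵇ (adjacentᵇ c) (allFin n)             ≡⟨ countᵇ-interval-allFin _ _ (Finₚ.toℕ<n (h c)) ⟩
    toℕ (h c) ∸ toℕ c                           ∎
    where open ≡-Reasoning

  stars⁻ : ∀ {cs a b} → (a , b) ∈ stars cs → a ∈ cs × b ∈ upperNeighbours a
  stars⁻ {cs} e∈ with c , c∈ , e∈′ ← find (∈-concatMap⁻ star {xs = cs} e∈)
    with _ , refl , k∈ ← star⁻ e∈′ = c∈ , k∈

  stars⁺ : ∀ {cs a b} → a ∈ cs → b ∈ upperNeighbours a → (a , b) ∈ stars cs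
  stars⁺ a∈ b∈ = ∈-concatMap⁺ star (lose a∈ (star⁺ b∈))

  _⊢_⟶_ : List (Edge × Bool) → Fin n → Fin n → Set
  z ⊢ u ⟶ v = ((u , v) , false) ∈ z ⊎ ((v , u) , true) ∈ z

  _≟ₗ_ : DecidableEquality (Edge × Bool)
  _≟ₗ_ = ≡-dec (≡-dec Finₚ._≟_ Finₚ._≟_) Boolₚ._≟_

  arrow? : ∀ z u v → Dec (z ⊢ u ⟶ v)
  arrow? z u v = any? (((u , v) , false) ≟ₗ_) z ⊎-dec any? (((v , u) , true) ≟ₗ_) z

  HasCycle : List (Edge × Bool) → Set
  HasCycle z = Σ (Fin n) λ x → Σ (List (Fin n)) λ xs →
    Unique (x ∷ xs) × Linked (z ⊢_⟶_) (x ∷ xs) × z ⊢ lastOf x xs ⟶ x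

  label : (E : List Edge) → Vec Bool (length E) → List (Edge × Bool)
  label []      Vec.[]       = []
  label (e ∷ E) (b Vec.∷ o)  = (e , b) ∷ label E o

  map-label-allVecs : ∀ E → map (label E) (allVecs (length E)) ≡ labellings E
  map-label-allVecs []      = refl
  map-label-allVecs (e ∷ E) = begin
    map (label (e ∷ E)) (concatMap (λ o → (false Vec.∷ o) ∷ (true Vec.∷ o) ∷ []) (allVecs (length E)))
      ≡⟨ Listₚ.map-concatMap (label (e ∷ E)) _ (allVecs (length E)) ⟩
    concatMap (extend ∘ label E) (allVecs (length E))
      ≡⟨ Listₚ.concatMap-map extend (label E) (allVecs (length E)) ⟨
    concatMap extend (map (label E) (allVecs (length E)))
      ≡⟨ cong (concatMap extend) (map-label-allVecs E) ⟩
    concatMap extend (labellings E) ∎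
    where
    open ≡-Reasoning
    extend : List (Edge × Bool) → List (List (Edge × Bool))
    extend z = ((e , false) ∷ z) ∷ ((e , true) ∷ z) ∷ []

  label-proj₁ : ∀ E o → map proj₁ (label E o) ≡ E
  label-proj₁ []      Vec.[]      = refl
  label-proj₁ (e ∷ E) (b Vec.∷ o) = cong (e ∷_) (label-proj₁ E o)

  label⁺ : ∀ E o k → (lookup E k , Vec.lookup o k) ∈ label E o
  label⁺ (e ∷ E) (b Vec.∷ o) Fin.zero    = here refl
  label⁺ (e ∷ E) (b Vec.∷ o) (Fin.suc k) = there (label⁺ E o k)

  label⁻ : ∀ E o {a b} → (a , b) ∈ label E o → ∃ λ k → lookup E k ≡ a × Vec.lookup o k ≡ b
  label⁻ []      Vec.[]      ()
  label⁻ (e ∷ E) (b Vec.∷ o) (here refl) = Fin.zero , refl , refl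
  label⁻ (e ∷ E) (b Vec.∷ o) (there ab∈) = let k , eqs = label⁻ E o ab∈ in Fin.suc k , eqs

  des≡trues : ∀ E o → countᵇ id (Vec.toList o) ≡ trues (label E o)
  des≡trues []      Vec.[]      = refl
  des≡trues (e ∷ E) (b Vec.∷ o) = cong (_ +_) (des≡trues E o)

  Arc⇒⟶ : ∀ o {u v} → Arc h o u v → label (edges h) o ⊢ u ⟶ v
  Arc⇒⟶ o (k , inj₁ (e≡ , b≡)) = inj₁ (subst (_∈ label (edges h) o) (cong₂ _,_ e≡ b≡) (label⁺ (edges h) o k))
  Arc⇒⟶ o (k , inj₂ (e≡ , b≡)) = inj₂ (subst (_∈ label (edges h) o) (cong₂ _,_ e≡ b≡) (label⁺ (edges h) o k))

  ⟶⇒Arc : ∀ o {u v} → label (edges h) o ⊢ u ⟶ v → Arc h o u v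
  ⟶⇒Arc o (inj₁ uv∈) = let k , eqs = label⁻ (edges h) o uv∈ in k , inj₁ eqs
  ⟶⇒Arc o (inj₂ vu∈) = let k , eqs = label⁻ (edges h) o vu∈ in k , inj₂ eqs

  acyclic⇒ : ∀ o → Acyclic h o → ¬ HasCycle (label (edges h) o)
  acyclic⇒ o acyclic (x , xs , u , path , back) = acyclic (x , xs , u , Linked.map (⟶⇒Arc o) path , ⟶⇒Arc o back)

  acyclic⇐ : ∀ o → ¬ HasCycle (label (edges h) o) → Acyclic h o
  acyclic⇐ o acyclic (x , xs , u , path , back) = acyclic (x , xs , u , Linked.map (Arc⇒⟶ o) path , Arc⇒⟶ o back)

  ⟶-++⁻ : ∀ z₁ {z₂ a b} → (z₁ ++ z₂) ⊢ a ⟶ b → z₁ ⊢ a ⟶ b ⊎ z₂ ⊢ a ⟶ b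
  ⟶-++⁻ z₁ (inj₁ ab∈) = Data.Sum.map inj₁ inj₁ (∈-++⁻ z₁ ab∈)
  ⟶-++⁻ z₁ (inj₂ ba∈) = Data.Sum.map inj₂ inj₂ (∈-++⁻ z₁ ba∈)

  ⟶-++⁺ˡ : ∀ {z₁ z₂ a b} → z₁ ⊢ a ⟶ b → (z₁ ++ z₂) ⊢ a ⟶ b
  ⟶-++⁺ˡ = Data.Sum.map ∈-++⁺ˡ ∈-++⁺ˡ

  ⟶-++⁺ʳ : ∀ z₁ {z₂ a b} → z₂ ⊢ a ⟶ b → (z₁ ++ z₂) ⊢ a ⟶ b
  ⟶-++⁺ʳ z₁ = Data.Sum.map (∈-++⁺ʳ z₁) (∈-++⁺ʳ z₁)

  targetArrow? : ∀ z (e′ e : Edge) → Dec (z ⊢ proj₂ e′ ⟶ proj₂ e)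
  targetArrow? z e′ e = arrow? z (proj₂ e′) (proj₂ e)

  -- A labelling z₁ of the star of c is consistent with an orientation z₂ of the larger vertices when the
  -- upper neighbours j with j ⟶ c (label true) form a down-set for the arrows of z₂.
  module Consistency (z₂ : List (Edge × Bool)) = Downsets (≡-dec Finₚ._≟_ Finₚ._≟_) (targetArrow? z₂)

  Consistent : Fin n → List (Edge × Bool) → List (Edge × Bool) → Set
  Consistent c z₁ z₂ = Consistency.Between z₂ (star c) (λ _ → false) (λ _ → true) z₁

  consistent? : ∀ c z₁ z₂ → Dec (Consistent c z₁ z₂)
  consistent? c z₁ z₂ = Consistency.between? z₂ (star c) (λ _ → false) (λ _ → true) z₁

  module Block (wi : WeaklyIncreasing h) {c cs} (seg : UpperSegment (c ∷ cs))
               {z₂ : List (Edge × Bool)} (labels₂ : map proj₁ z₂ ≡ stars cs) where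

    open Consistency z₂ using (DownClosed; StrictTotalOn)

    c<cs : ∀ {a} → a ∈ cs → c Fin.< a
    c<cs = All.lookup (upperSegment-below seg)

    c≢neighbour : ∀ {k} → k ∈ upperNeighbours c → c ≢ k
    c≢neighbour = Finₚ.<⇒≢ ∘ proj₁ ∘ upperNeighbours⁻

    z₂-arrow : ∀ {a b} → z₂ ⊢ a ⟶ b → c Fin.< a × c Fin.< b × a ≢ b
    z₂-arrow (inj₁ ab∈) with a∈ , b∈ ← stars⁻ (labelled⁻ labels₂ ab∈) =
      c<cs a∈ , ℕₚ.<-trans (c<cs a∈) a<b , Finₚ.<⇒≢ a<b
      where a<b = proj₁ (upperNeighbours⁻ b∈)
    z₂-arrow (inj₂ ba∈) with b∈ , a∈ ← stars⁻ (labelled⁻ labels₂ ba∈) =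
      ℕₚ.<-trans (c<cs b∈) b<a , c<cs b∈ , Finₚ.<⇒≢ b<a ∘ sym
      where b<a = proj₁ (upperNeighbours⁻ a∈)

    z₂-≢ : ∀ {a b} → z₂ ⊢ a ⟶ b → a ≢ b
    z₂-≢ = proj₂ ∘ proj₂ ∘ z₂-arrow

    ordered : ∀ {a b} → a ∈ upperNeighbours c → b ∈ upperNeighbours c → a Fin.< b → z₂ ⊢ a ⟶ b ⊎ z₂ ⊢ b ⟶ a
    ordered a∈ b∈ a<b with c<a , _ ← upperNeighbours⁻ a∈ | _ , b≤hc ← upperNeighbours⁻ b∈
      with labelled⁺ labels₂ (stars⁺ (upperSegment-above seg c<a)
                                     (upperNeighbours⁺ a<b (ℕₚ.≤-trans b≤hc (wi c _ (ℕₚ.<⇒≤ c<a)))))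
    ... | false , ab∈ = inj₁ (inj₁ ab∈)
    ... | true  , ab∈ = inj₂ (inj₂ ab∈)

    clique : ∀ {j k} → j ∈ upperNeighbours c → k ∈ upperNeighbours c → j ≢ k → z₂ ⊢ j ⟶ k ⊎ z₂ ⊢ k ⟶ j
    clique {j} {k} j∈ k∈ j≢k with Finₚ.<-cmp j k
    ... | tri< j<k _ _ = ordered j∈ k∈ j<k
    ... | tri≈ _ j≡k _ = ⊥-elim (j≢k j≡k)
    ... | tri> _ _ k<j = Data.Sum.swap (ordered k∈ j∈ k<j)

    starOrder : ¬ HasCycle z₂ → StrictTotalOn (star c)
    starOrder acyclic₂ = record { compare = compare ; asym = asym ; ≺-trans = ≺-trans }
      where
      asym : ∀ {e e′} → e ∈ star c → e′ ∈ star c → z₂ ⊢ proj₂ e ⟶ proj₂ e′ → ¬ z₂ ⊢ proj₂ e′ ⟶ proj₂ e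
      asym _ _ j⟶k k⟶j = acyclic₂ (_ , _ ∷ [] , (z₂-≢ j⟶k ∷ []) ∷ [] ∷ [] , j⟶k ∷ [-] , k⟶j)
      compare : ∀ {e e′} → e ∈ star c → e′ ∈ star c → e ≢ e′ → z₂ ⊢ proj₂ e ⟶ proj₂ e′ ⊎ z₂ ⊢ proj₂ e′ ⟶ proj₂ e
      compare e∈ e′∈ e≢e′ with star⁻ e∈ | star⁻ e′∈
      ... | j , refl , j∈ | k , refl , k∈ = clique j∈ k∈ (e≢e′ ∘ cong (c ,_))
      ≺-trans : ∀ {e e′ e″} → e ∈ star c → e′ ∈ star c → e″ ∈ star c →
        z₂ ⊢ proj₂ e ⟶ proj₂ e′ → z₂ ⊢ proj₂ e′ ⟶ proj₂ e″ → z₂ ⊢ proj₂ e ⟶ proj₂ e″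
      ≺-trans {e} {e′} {e″} e∈ e′∈ e″∈ j⟶k k⟶l with star⁻ e∈ | star⁻ e″∈
      ... | j , refl , j∈ | l , refl , l∈ with j Finₚ.≟ l
      ...   | yes refl = ⊥-elim (asym e∈ e′∈ j⟶k k⟶l)
      ...   | no j≢l with clique j∈ l∈ j≢l
      ...     | inj₁ j⟶l = j⟶l
      ...     | inj₂ l⟶j = ⊥-elim (acyclic₂ (j , proj₂ e′ ∷ l ∷ [] , distinct , j⟶k ∷ k⟶l ∷ [-] , l⟶j))
        where
        distinct : Unique (j ∷ proj₂ e′ ∷ l ∷ [])
        distinct = (z₂-≢ j⟶k ∷ j≢l ∷ []) ∷ (z₂-≢ k⟶l ∷ []) ∷ [] ∷ []

    module _ {z₁ : List (Edge × Bool)} (labels₁ : map proj₁ z₁ ≡ star c) where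

      z₁-arrow : ∀ {a b} → z₁ ⊢ a ⟶ b →
        (a ≡ c × b ∈ upperNeighbours c × ((c , b) , false) ∈ z₁) ⊎
        (b ≡ c × a ∈ upperNeighbours c × ((c , a) , true) ∈ z₁)
      z₁-arrow (inj₁ ab∈) with _ , refl , b∈ ← star⁻ (labelled⁻ labels₁ ab∈) = inj₁ (refl , b∈ , ab∈)
      z₁-arrow (inj₂ ba∈) with _ , refl , a∈ ← star⁻ (labelled⁻ labels₁ ba∈) = inj₂ (refl , a∈ , ba∈)

      z₁-functional : ∀ {k b b′} → ((c , k) , b) ∈ z₁ → ((c , k) , b′) ∈ z₁ → b ≡ b′
      z₁-functional = labelled-functional (subst Unique (sym labels₁) (star-unique c))

      triangle : ∀ {j k} → j ∈ upperNeighbours c → k ∈ upperNeighbours c → z₂ ⊢ k ⟶ j → Unique (c ∷ k ∷ j ∷ [])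
      triangle j∈ k∈ k⟶j = (c≢neighbour k∈ ∷ c≢neighbour j∈ ∷ []) ∷ (z₂-≢ k⟶j ∷ []) ∷ [] ∷ []

      consistent⇒ : ¬ HasCycle (z₁ ++ z₂) → ¬ HasCycle z₂ × Consistent c z₁ z₂
      consistent⇒ acyclic =
        (λ (x , xs , u , path , back) → acyclic (x , xs , u , Linked.map (⟶-++⁺ʳ z₁) path , ⟶-++⁺ʳ z₁ back)) ,
        down , (λ _ ()) , _
        where
        down : DownClosed (star c) z₁
        down e∈ e′∈ k⟶c k⟶j with star⁻ e∈ | star⁻ e′∈
        ... | j , refl , j∈ | k , refl , k∈ with labelled⁺ labels₁ (star⁺ k∈)
        ...   | true  , ck∈ = ck∈
        ...   | false , ck∈ = ⊥-elim (acyclic (c , k ∷ j ∷ [] , triangle j∈ k∈ k⟶j ,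
                                ⟶-++⁺ˡ (inj₁ ck∈) ∷ ⟶-++⁺ʳ z₁ k⟶j ∷ [-] , ⟶-++⁺ˡ (inj₂ k⟶c)))

      avoiding-c : ∀ {ys} → c ∉ ys → Linked ((z₁ ++ z₂) ⊢_⟶_) ys → Linked (z₂ ⊢_⟶_) ys
      avoiding-c c∉ = Linked-map∈ only-z₂
        where
        only-z₂ : ∀ {a b} → a ∈ _ → b ∈ _ → (z₁ ++ z₂) ⊢ a ⟶ b → z₂ ⊢ a ⟶ b
        only-z₂ a∈ b∈ a⟶b with ⟶-++⁻ z₁ a⟶b
        ... | inj₂ a⟶b′ = a⟶b′
        ... | inj₁ a⟶b′ with z₁-arrow a⟶b′
        ...   | inj₁ (refl , _) = ⊥-elim (c∉ a∈)
        ...   | inj₂ (refl , _) = ⊥-elim (c∉ b∈)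

      -- Started at c, a cycle leaves c towards an upper neighbour k and returns from one j; the clique edge
      -- between j and k either closes a cycle of z₂ or, by down-closure, forces the arrow k ⟶ c.
      through-c : ¬ HasCycle z₂ → DownClosed (star c) z₁ → ∀ {ys} → Unique (c ∷ ys) →
        ¬ Linked ((z₁ ++ z₂) ⊢_⟶_) ((c ∷ ys) ++ [ c ])
      through-c _ _ {[]} _ (c⟶c ∷ [-]) with ⟶-++⁻ z₁ c⟶c
      ... | inj₂ c⟶c′ = z₂-≢ c⟶c′ refl
      ... | inj₁ c⟶c′ with z₁-arrow c⟶c′
      ...   | inj₁ (_ , k∈ , _) = c≢neighbour k∈ refl
      ...   | inj₂ (_ , k∈ , _) = c≢neighbour k∈ refl
      through-c acyclic₂ down {k ∷ rest} (c∉ ∷ u) (c⟶k ∷ cycle) =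
        closing rest u path₂ (leaving c⟶k) (entering (lastOf-∈ k rest) j⟶c)
        where
        c∉ks : c ∉ k ∷ rest
        c∉ks = Allₚ.All¬⇒¬Any c∉
        path×j⟶c = Linked-∷ʳ⁻ k rest cycle
        path₂ : Linked (z₂ ⊢_⟶_) (k ∷ rest)
        path₂ = avoiding-c c∉ks (proj₁ path×j⟶c)
        j⟶c : (z₁ ++ z₂) ⊢ lastOf k rest ⟶ c
        j⟶c = proj₂ path×j⟶c
        leaving : (z₁ ++ z₂) ⊢ c ⟶ k → k ∈ upperNeighbours c × ((c , k) , false) ∈ z₁
        leaving c⟶k′ with ⟶-++⁻ z₁ c⟶k′
        ... | inj₂ c⟶k₂ = ⊥-elim (Finₚ.<-irrefl refl (proj₁ (z₂-arrow c⟶k₂)))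
        ... | inj₁ c⟶k₁ with z₁-arrow c⟶k₁
        ...   | inj₁ (_ , k∈ , ck∈) = k∈ , ck∈
        ...   | inj₂ (k≡c , _)      = ⊥-elim (c∉ks (here (sym k≡c)))
        entering : ∀ {j} → j ∈ k ∷ rest → (z₁ ++ z₂) ⊢ j ⟶ c → j ∈ upperNeighbours c × ((c , j) , true) ∈ z₁
        entering j∈ j⟶c′ with ⟶-++⁻ z₁ j⟶c′
        ... | inj₂ j⟶c₂ = ⊥-elim (Finₚ.<-irrefl refl (proj₁ (proj₂ (z₂-arrow j⟶c₂))))
        ... | inj₁ j⟶c₁ with z₁-arrow j⟶c₁
        ...   | inj₁ (j≡c , _)      = ⊥-elim (c∉ks (subst (_∈ k ∷ rest) j≡c j∈))
        ...   | inj₂ (_ , j∈N , cj∈) = j∈N , cj∈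
        closing : ∀ rest → Unique (k ∷ rest) → Linked (z₂ ⊢_⟶_) (k ∷ rest) →
          k ∈ upperNeighbours c × ((c , k) , false) ∈ z₁ →
          lastOf k rest ∈ upperNeighbours c × ((c , lastOf k rest) , true) ∈ z₁ → ⊥
        closing []       _ _     (_ , ck∈) (_ , cj∈) = case z₁-functional ck∈ cj∈ of λ ()
        closing (r ∷ rs) u path₂ (k∈ , ck∈) (j∈ , cj∈)
          with clique j∈ k∈ (λ j≡k → Uniqueₚ.Unique[x∷xs]⇒x∉xs u (subst (_∈ r ∷ rs) j≡k (lastOf-∈ r rs)))
        ... | inj₁ j⟶k = acyclic₂ (k , r ∷ rs , u , path₂ , j⟶k)
        ... | inj₂ k⟶j = case z₁-functional ck∈ (down (star⁺ j∈) (star⁺ k∈) cj∈ k⟶j) of λ ()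

      consistent⇐ : ¬ HasCycle z₂ → Consistent c z₁ z₂ → ¬ HasCycle (z₁ ++ z₂)
      consistent⇐ acyclic₂ (down , _) (x , xs , u , path , back) with c ∈? (x ∷ xs)
        where open import Data.List.Membership.DecPropositional Finₚ._≟_ using (_∈?_)
      ... | no c∉ = acyclic₂ (x , xs , u , avoiding-c c∉ path , Linked.head (avoiding-c c∉′ (back ∷ [-])))
        where
        c∉′ : c ∉ lastOf x xs ∷ x ∷ []
        c∉′ (here c≡)         = c∉ (subst (_∈ x ∷ xs) (sym c≡) (lastOf-∈ x xs))
        c∉′ (there (here c≡)) = c∉ (here c≡)
      ... | yes c∈ with rest , u′ , cycle ← rotate c∈ u (Linked-∷ʳ⁺ x xs path back) =
        through-c acyclic₂ down u′ cycle

  AcyclicBlocks : List (Fin n) → List (Edge × Bool) → Set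
  AcyclicBlocks []       z = ⊤
  AcyclicBlocks (c ∷ cs) z =
    Consistent c (take (length (star c)) z) (drop (length (star c)) z) × AcyclicBlocks cs (drop (length (star c)) z)

  acyclicBlocks? : ∀ cs z → Dec (AcyclicBlocks cs z)
  acyclicBlocks? []       z = yes tt
  acyclicBlocks? (c ∷ cs) z = consistent? c _ _ ×-dec acyclicBlocks? cs _

  module _ (wi : WeaklyIncreasing h) where

    acyclic⇒blocks : ∀ {cs z} → UpperSegment cs → map proj₁ z ≡ stars cs → ¬ HasCycle z → AcyclicBlocks cs z
    acyclicBlocks⇒ : ∀ {cs z} → UpperSegment cs → map proj₁ z ≡ stars cs → AcyclicBlocks cs z → ¬ HasCycle z

    acyclic⇒blocks {[]}     _   _      _       = tt
    acyclic⇒blocks {c ∷ cs} {z} seg labels acyclic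
      with labels₁ , labels₂ ← labelling-++⁻ (star c) labels
      with acyclic₂ , consistent ← Block.consistent⇒ wi seg labels₂ labels₁
                                     (acyclic ∘ subst HasCycle (Listₚ.take++drop≡id (length (star c)) z)) =
      consistent , acyclic⇒blocks (upperSegment-tail seg) labels₂ acyclic₂

    acyclicBlocks⇒ {[]}     {[]} _ _ _ (_ , _ , _ , _ , inj₁ ())
    acyclicBlocks⇒ {[]}     {[]} _ _ _ (_ , _ , _ , _ , inj₂ ())
    acyclicBlocks⇒ {c ∷ cs} {z} seg labels (consistent , blocks) cycle
      with labels₁ , labels₂ ← labelling-++⁻ (star c) labels =
      Block.consistent⇐ wi seg labels₂ labels₁ (acyclicBlocks⇒ (upperSegment-tail seg) labels₂ blocks) consistent
        (subst HasCycle (sym (Listₚ.take++drop≡id (length (star c)) z)) cycle)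

    module _ {c ℓ : Level} (R : CommutativeSemiring c ℓ) (t : CommutativeSemiring.Carrier R) where
      open Sums R
      open HessenbergFactor R t h
      open import Relation.Binary.Reasoning.Setoid setoid
      open import Algebra.Properties.CommutativeSemigroup *-commutativeSemigroup using (interchange)

      blockWeight : List (Fin n) → List (Edge × Bool) → Carrier
      blockWeight cs z = indicator (acyclicBlocks? cs z) ⊗ pow t (trues z)

      sum-consistent : ∀ {c cs z₂} → UpperSegment (c ∷ cs) → map proj₁ z₂ ≡ stars cs → ¬ HasCycle z₂ →
        sumL (λ z₁ → indicator (consistent? c z₁ z₂) ⊗ pow t (trues z₁)) (labellings (star c)) ≈ factor c
      sum-consistent {c} {cs} {z₂} seg labels₂ acyclic₂ = begin
        sumL (weight R t (star c) (λ _ → false) (λ _ → true)) (labellings (star c))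
          ≈⟨ sum-weight R t (star c) (star-unique c) (Block.starOrder wi seg labels₂ acyclic₂) bounds ⟩
        powSum R t (countᵇ (λ _ → false) (star c)) (countᵇ (λ _ → true) (star c))
          ≡⟨ cong₂ (powSum R t) (countᵇ-false (star c)) (trans (countᵇ-true (star c)) (length-star c)) ⟩
        1# ⊗ qint t (suc (toℕ (h c) ∸ toℕ c))
          ≈⟨ *-identityˡ _ ⟩
        qint t (suc (toℕ (h c) ∸ toℕ c))
          ≡⟨ cong (qint t) (ℕₚ.+-comm 1 (toℕ (h c) ∸ toℕ c)) ⟩
        factor c ∎
        where
        open Consistency z₂ using (Bounds; weight; powSum; sum-weight)
        bounds : Bounds (star c) (λ _ → false) (λ _ → true)
        bounds = record { lo-closed = λ _ _ () ; hi-closed = _ ; lo⊆hi = _ }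

      blockWeight-∷ : ∀ {c cs z₂} z₁ → map proj₁ z₁ ≡ star c →
        blockWeight (c ∷ cs) (z₁ ++ z₂) ≈ (indicator (consistent? c z₁ z₂) ⊗ pow t (trues z₁)) ⊗ blockWeight cs z₂
      blockWeight-∷ {c} {cs} {z₂} z₁ labels₁ = begin
        indicator (acyclicBlocks? (c ∷ cs) (z₁ ++ z₂)) ⊗ pow t (trues (z₁ ++ z₂))
          ≈⟨ *-cong (indicator-cong to from (acyclicBlocks? (c ∷ cs) (z₁ ++ z₂)) (consistent? c z₁ z₂ ×-dec acyclicBlocks? cs z₂))
                    (reflexive (cong (pow t) (countᵇ-++ proj₂ z₁ z₂))) ⟩
        indicator (consistent? c z₁ z₂ ×-dec acyclicBlocks? cs z₂) ⊗ pow t (trues z₁ + trues z₂)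
          ≈⟨ *-cong (indicator-× (consistent? c z₁ z₂) (acyclicBlocks? cs z₂) (consistent? c z₁ z₂ ×-dec acyclicBlocks? cs z₂))
                    (pow-+ t (trues z₁) (trues z₂)) ⟩
        (indicator (consistent? c z₁ z₂) ⊗ indicator (acyclicBlocks? cs z₂)) ⊗ (pow t (trues z₁) ⊗ pow t (trues z₂))
          ≈⟨ interchange _ _ _ _ ⟩
        (indicator (consistent? c z₁ z₂) ⊗ pow t (trues z₁)) ⊗ blockWeight cs z₂ ∎
        where
        ℓ≡ : length z₁ ≡ length (star c)
        ℓ≡ = trans (sym (Listₚ.length-map proj₁ z₁)) (cong length labels₁)
        take≡ : take (length (star c)) (z₁ ++ z₂) ≡ z₁
        take≡ = subst (λ k → take k (z₁ ++ z₂) ≡ z₁) ℓ≡ (take-length-++ z₁ z₂)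
        drop≡ : drop (length (star c)) (z₁ ++ z₂) ≡ z₂
        drop≡ = subst (λ k → drop k (z₁ ++ z₂) ≡ z₂) ℓ≡ (drop-length-++ z₁ z₂)
        to : AcyclicBlocks (c ∷ cs) (z₁ ++ z₂) → Consistent c z₁ z₂ × AcyclicBlocks cs z₂
        to = subst₂ (λ x y → Consistent c x y × AcyclicBlocks cs y) take≡ drop≡
        from : Consistent c z₁ z₂ × AcyclicBlocks cs z₂ → AcyclicBlocks (c ∷ cs) (z₁ ++ z₂)
        from = subst₂ (λ x y → Consistent c x y × AcyclicBlocks cs y) (sym take≡) (sym drop≡)

      sum-acyclicBlocks : ∀ {cs} → UpperSegment cs → sumL (blockWeight cs) (labellings (stars cs)) ≈ prodL factor cs
      sum-acyclicBlocks {[]}     _   = ≈-trans (+-identityʳ _) (*-identityˡ _)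
      sum-acyclicBlocks {c ∷ cs} seg = begin
        sumL (blockWeight (c ∷ cs)) (labellings (star c ++ stars cs))
          ≈⟨ sum-labellings-++ R (star c) (stars cs) (blockWeight (c ∷ cs)) ⟩
        sumL (λ z₂ → sumL (λ z₁ → blockWeight (c ∷ cs) (z₁ ++ z₂)) (labellings (star c))) (labellings (stars cs))
          ≈⟨ sumL-cong (labellings (stars cs)) step ⟩
        sumL (λ z₂ → factor c ⊗ blockWeight cs z₂) (labellings (stars cs))
          ≈⟨ sumL-*ˡ (factor c) (blockWeight cs) (labellings (stars cs)) ⟩
        factor c ⊗ sumL (blockWeight cs) (labellings (stars cs))
          ≈⟨ *-congˡ (sum-acyclicBlocks (upperSegment-tail seg)) ⟩
        factor c ⊗ prodL factor cs ∎
        where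
        step : ∀ {z₂} → z₂ ∈ labellings (stars cs) →
          sumL (λ z₁ → blockWeight (c ∷ cs) (z₁ ++ z₂)) (labellings (star c)) ≈ factor c ⊗ blockWeight cs z₂
        step {z₂} z₂∈ = begin
          sumL (λ z₁ → blockWeight (c ∷ cs) (z₁ ++ z₂)) (labellings (star c))
            ≈⟨ sumL-cong (labellings (star c)) (λ z₁∈ → blockWeight-∷ _ (labellings-proj₁ (star c) z₁∈)) ⟩
          sumL (λ z₁ → (indicator (consistent? c z₁ z₂) ⊗ pow t (trues z₁)) ⊗ blockWeight cs z₂) (labellings (star c))
            ≈⟨ sumL-*ʳ (blockWeight cs z₂) _ (labellings (star c)) ⟩
          sumL (λ z₁ → indicator (consistent? c z₁ z₂) ⊗ pow t (trues z₁)) (labellings (star c)) ⊗ blockWeight cs z₂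
            ≈⟨ inner (acyclicBlocks? cs z₂) ⟩
          factor c ⊗ blockWeight cs z₂ ∎
          where
          labels₂ = labellings-proj₁ (stars cs) z₂∈
          inner : (blocks? : Dec (AcyclicBlocks cs z₂)) →
            sumL (λ z₁ → indicator (consistent? c z₁ z₂) ⊗ pow t (trues z₁)) (labellings (star c)) ⊗
              (indicator blocks? ⊗ pow t (trues z₂)) ≈
            factor c ⊗ (indicator blocks? ⊗ pow t (trues z₂))
          inner (yes blocks) = *-congʳ (sum-consistent seg labels₂ (acyclicBlocks⇒ (upperSegment-tail seg) labels₂ blocks))
          inner (no _)       = ≈-trans (*-congˡ (zeroˡ _)) (≈-trans (zeroʳ _) (≈-sym (≈-trans (*-congˡ (zeroˡ _)) (zeroʳ _))))

      sum-acyclicOrientations : (acyclic? : Decidable (Acyclic h)) →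
        prodL factor (allFin n) ≈ sumL (pow t ∘ des h) (filter acyclic? (allOrientations h))
      sum-acyclicOrientations acyclic? = ≈-sym $ begin
        sumL (pow t ∘ des h) (filter acyclic? (allVecs L))
          ≈⟨ sumL-filter acyclic? (pow t ∘ des h) (allVecs L) ⟩
        sumL (λ o → indicator (acyclic? o) ⊗ pow t (des h o)) (allVecs L)
          ≈⟨ sumL-cong (allVecs L) (λ {o} _ → labelled-weight o) ⟩
        sumL (blockWeight (allFin n) ∘ label (edges h)) (allVecs L)
          ≡⟨ sumL-map (blockWeight (allFin n)) (label (edges h)) (allVecs L) ⟨
        sumL (blockWeight (allFin n)) (map (label (edges h)) (allVecs L))
          ≡⟨ cong (sumL (blockWeight (allFin n))) (trans (map-label-allVecs (edges h)) (cong labellings edges≡stars)) ⟩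
        sumL (blockWeight (allFin n)) (labellings (stars (allFin n)))
          ≈⟨ sum-acyclicBlocks allFin-upperSegment ⟩
        prodL factor (allFin n) ∎
        where
        L = length (edges h)
        labelled-weight : ∀ o → indicator (acyclic? o) ⊗ pow t (des h o) ≈ blockWeight (allFin n) (label (edges h) o)
        labelled-weight o = *-cong
          (indicator-cong (acyclic⇒blocks allFin-upperSegment labels ∘ acyclic⇒ o)
                          (acyclic⇐ o ∘ acyclicBlocks⇒ allFin-upperSegment labels) (acyclic? o) (acyclicBlocks? _ _))
          (reflexive (cong (pow t) (des≡trues (edges h) o)))
          where
          labels : map proj₁ (label (edges h) o) ≡ stars (allFin n)
          labels = trans (label-proj₁ (edges h) o) edges≡stars

mainTheorem2 : {c ℓ : Level} (n : ℕ) → 1 ≤ n → (h : Fin n → Fin n) →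
    WeaklyIncreasing h → Extensive h →
    (acyclic? : Decidable (Acyclic h)) →
    (R : CommutativeSemiring c ℓ) → (t : CommutativeSemiring.Carrier R) →
    let open CommutativeSemiring R using (_≈_) in
    let open Poly R in
    let P = prodL (λ i → qint t (toℕ (h i) ∸ toℕ i + 1)) (allFin n) in
    (sumL (λ w → pow t (inv h w)) (tymoczkoConfigs h) ≈ P)
    × (P ≈ sumL (λ o → pow t (des h o)) (filter acyclic? (allOrientations h)))
mainTheorem2 n _ h wi ex acyclic? R t =
  Inversions.sum-tymoczkoConfigs h wi ex R t , Orientations.sum-acyclicOrientations h wi R t acyclic?
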